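{- For all $k\ge1$, $$N_{k(k+1)(k-1)(k+2)(k-2)(k+3)\ldots1(2k)}(x)=\frac{U_{k-1}\left(\frac{1-x}{2x}\right)}{xU_k\left(\frac{1-x}{2x}\right)},$$ and $$N_{(k+1)k(k+2)(k-1)(k+3)\ldots1(2k+1)}(x)=\frac{U_k\left(\frac{1-x}{2x}\right)+U_{k-1}\left(\frac{1-x}{2x}\right)}{x\left(U_{k+1}\left(\frac{1-x}{2x}\right)+U_k\left(\frac{1-x}{2x}\right)\right)}.$$
   Context: A permutation $\pi=\pi_1\cdots\pi_n$ is a Motzkin permutation if it avoids the pattern $132$ (no $i<j<k$ with $\pi_i<\pi_k<\pi_j$) and there are no indices $a<b$ with $\pi_a<\pi_b<\pi_{b+1}$; $\mathfrak M_n$ is the set of them. For a permutation $\sigma$, $N_\sigma(x)=\sum_{n\ge0}|\mathfrak M_n(\sigma)|x^n$, where $\mathfrak M_n(\sigma)$ is the set of Motzkin permutations of length $n$ avoiding $\sigma$ classically. The first pattern is the permutation of $\{1,\dots,2k\}$ given by $k,k+1,k-1,k+2,k-2,k+3,\dots,1,2k$; the second is the permutation of $\{1,\dots,2k+1\}$ given by $k+1,k,k+2,k-1,k+3,\dots,1,2k+1$. $U_r$ is the Chebyshev polynomial of the second kind: $U_0(t)=1$, $U_1(t)=2t$, $U_r(t)=2tU_{r-1}(t)-U_{r-2}(t)$, $U_{ -1}=0$. -}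

module Defs where

open import Data.Bool using (Bool; true; false; _∧_; not; _≟_)
open import Data.Nat as ℕ using (ℕ; zero; suc; _∸_; _<ᵇ_; _≡ᵇ_)
open import Data.Integer as ℤ using (ℤ; +_)
open import Data.List using (List; []; _∷_; _++_; map; concatMap; length; filter; upTo; zip; foldr)
open import Data.Bool.ListAction using (any; all)
open import Data.Product using (_,_)
open import Relation.Nullary.Decidable using (does)
open import Relation.Binary.PropositionalEquality using (_≡_)

insertions : ℕ → List ℕ → List (List ℕ)
insertions x []       = (x ∷ []) ∷ []
insertions x (y ∷ ys) = (x ∷ y ∷ ys) ∷ map (y ∷_) (insertions x ys)

perms : ℕ → List (List ℕ)
perms zero    = [] ∷ []
perms (suc n) = concatMap (insertions (suc n)) (perms n)

subseqs : List ℕ → List (List ℕ)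
subseqs []       = [] ∷ []
subseqs (x ∷ xs) = map (x ∷_) (subseqs xs) ++ subseqs xs

_==_ : Bool → Bool → Bool
true  == b = b
false == b = not b

orderIso : List ℕ → List ℕ → Bool
orderIso []       []       = true
orderIso (a ∷ as) (b ∷ bs) =
  all (λ { (x , y) → ((a <ᵇ x) == (b <ᵇ y)) ∧ ((x <ᵇ a) == (y <ᵇ b)) }) (zip as bs)
  ∧ orderIso as bs
orderIso _        _        = false

contains : List ℕ → List ℕ → Bool
contains π σ = any (orderIso σ) (subseqs π)

avoids : List ℕ → List ℕ → Bool
avoids π σ = not (contains π σ)

-- no a < b with π_a < π_b < π_{b+1}; `pre` holds the entries π_a, a < b
noRiseAfterSmaller : List ℕ → List ℕ → Bool
noRiseAfterSmaller pre []           = true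
noRiseAfterSmaller pre (y ∷ [])     = true
noRiseAfterSmaller pre (y ∷ z ∷ zs) =
  not ((y <ᵇ z) ∧ any (_<ᵇ y) pre) ∧ noRiseAfterSmaller (y ∷ pre) (z ∷ zs)

isMotzkin : List ℕ → Bool
isMotzkin π = avoids π (1 ∷ 3 ∷ 2 ∷ []) ∧ noRiseAfterSmaller [] π

motzkinAvoiding : ℕ → List ℕ → List (List ℕ)
motzkinAvoiding n σ = filter (λ π → (isMotzkin π ∧ avoids π σ) ≟ true) (perms n)

-- k, k+1, k-1, k+2, …, 1, 2k
pattern₁ : ℕ → List ℕ
pattern₁ k = concatMap (λ i → (k ∸ i) ∷ (suc k ℕ.+ i) ∷ []) (upTo k)

-- k+1, k, k+2, k-1, k+3, …, 1, 2k+1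
pattern₂ : ℕ → List ℕ
pattern₂ k = suc k ∷ concatMap (λ i → (k ∸ i) ∷ (2 ℕ.+ k ℕ.+ i) ∷ []) (upTo k)

PS : Set
PS = ℕ → ℤ

_⊕_ : PS → PS → PS
(f ⊕ g) n = f n ℤ.+ g n

_⊛_ : PS → PS → PS
(f ⊛ g) n = foldr ℤ._+_ (+ 0) (map (λ i → f i ℤ.* g (n ∸ i)) (upTo (suc n)))

const : ℤ → PS
const c zero    = c
const c (suc n) = + 0

X : PS
X (suc zero) = + 1
X _          = + 0

_≐_ : PS → PS → Set
f ≐ g = ∀ n → f n ≡ g n

N : List ℕ → PS
N σ n = + length (motzkinAvoiding n σ)

-- Chebyshev polynomials with cleared denominators:
--   Uh r = (2x)^r · U_r((1-x)/(2x)),  a polynomial in x.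
-- From U_r(t) = 2t U_{r-1}(t) − U_{r-2}(t) with 2t·2x = 2(1−x):
--   Uh 0 = 1, Uh 1 = 2(1−x), Uh (r+2) = 2(1−x)·Uh (r+1) − 4x²·Uh r.

twoOneMinusX : PS
twoOneMinusX = const (+ 2) ⊕ (const (ℤ.- (+ 2)) ⊛ X)

minusFourX² : PS
minusFourX² = const (ℤ.- (+ 4)) ⊛ (X ⊛ X)

Uh : ℕ → PS
Uh zero          = const (+ 1)
Uh (suc zero)    = twoOneMinusX
Uh (suc (suc r)) = (twoOneMinusX ⊛ Uh (suc r)) ⊕ (minusFourX² ⊛ Uh r)

twoX : PS
twoX = const (+ 2) ⊛ X

-- Both pattern families satisfy σ (k+1) = (σ k shifted up by one) followed by 1 and a new maximum,
-- starting from the empty pattern resp. the pattern 1.  Cut a Motzkin permutation of length n+1 at its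
-- maximum: it is either (n+1) β, or α′ m (n+1) β with β < m < α′, since 132-avoidance puts everything
-- after the maximum below everything before it and the Motzkin condition at the rise m (n+1) puts m
-- below α′.  An occurrence of σ (k+1) in α′ m (n+1) β lies in β or has its σ k part in α′, and
-- conversely α′ m (n+1) contains σ (k+1) as soon as α′ contains σ k.  Counting both cases gives
-- N (k+1) = 1 + x N (k+1) + x² N k N (k+1), i.e. N (k+1) (1 − x − x² N k) = 1.  The Chebyshev
-- recurrence, scaled by (2x)^k, reads Uh (k+2) = 2(1−x) Uh (k+1) − 4x² Uh k, and with it the identity
-- V (k+1) = 2 V k (1 − x − x² N k) propagates from k = 0 to all k, for V = Uh in the first family and
-- V k = Uh (k+1) + 2x Uh k in the second.  Multiplying by x N (k+1) gives the claim.

module Submission where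

open import Defs
open import Algebra.Bundles using (CommutativeRing)
open import Algebra.Structures using (IsCommutativeRing)
import Algebra.Solver.Ring
import Algebra.Solver.Ring.AlmostCommutativeRing as ACR
open import Data.Bool using (Bool; true; false; _∧_; _∨_; not; T)
open import Data.Bool.ListAction using (any; all)
import Data.Bool.Properties as Bool
open import Data.Bool.Properties using (∧-zeroʳ)
open import Data.Empty using (⊥; ⊥-elim)
open import Data.Integer as ℤ using (ℤ; +_)
import Data.Integer.Properties as ℤ
open import Data.Integer.Solver using (module +-*-Solver)
open import Data.List
  using (List; []; _∷_; _++_; [_]; _ʳ++_; map; length; foldr; zip; concat; concatMap; upTo;
         cartesianProductWith; initLast; _∷ʳ′_)
open import Data.List.Membership.Propositional using (_∈_; _∉_; find; lose)
open import Data.List.Membership.Propositional.Properties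
  using (∈-++⁺ˡ; ∈-++⁺ʳ; ∈-++⁻; ∈-map⁺; ∈-map⁻; ∈-concatMap⁺; ∈-concatMap⁻; ∈-upTo⁺; ∈-upTo⁻; ∈-∃++; ∈-insert;
         ∈-filter⁺; ∈-filter⁻; ∈-cartesianProductWith⁺; ∈-cartesianProductWith⁻)
open import Data.List.Membership.Propositional.Properties.WithK using (unique∧set⇒bag)
open import Data.List.Properties
  using (++-assoc; ++-identityʳ; ∷-injective; ∷-injectiveʳ; ∷ʳ-injective; length-++; length-map; map-++; map-∘;
         map-id; map-id-local; map-cong; map-cong-local; map-injective; map-applyUpTo; map-upTo; map-concatMap;
         upTo-∷ʳ; concatMap-++; filter-accept; filter-none)
open import Data.List.Relation.Binary.BagAndSetEquality using (∼bag⇒↭)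
open import Data.List.Relation.Binary.Permutation.Propositional.Properties using (↭-length)
open import Data.List.Relation.Unary.All as All using (All; []; _∷_)
open import Data.List.Relation.Unary.All.Properties using (¬Any⇒All¬) renaming (map⁺ to All-map⁺)
open import Data.List.Relation.Unary.AllPairs using ([]; _∷_)
open import Data.List.Relation.Unary.Any using (here; there)
import Data.List.Relation.Unary.Any.Properties as Any
open import Data.List.Relation.Unary.Unique.Propositional using (Unique)
import Data.List.Relation.Unary.Unique.Propositional.Properties as Unique
open import Data.Maybe as Maybe using ()
open import Data.Nat using (ℕ; zero; suc; z≤n; s≤s; _≤_; _<_; _≥_; _<ᵇ_; _+_; _*_; _∸_)
open import Data.Nat.ListAction using (sum)
import Data.Nat.Properties as ℕ
open import Data.List.Relation.Binary.Sublist.Propositional {A = ℕ}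
  using (_⊆_; []; _∷_; _∷ʳ_; minimum; ⊆-refl; ⊆-trans; lookup; from∈)
open import Data.List.Relation.Binary.Sublist.Propositional.Properties
  using (++⁺; ++⁺ˡ; ++⁺ʳ; length-mono-≤; All-resp-⊆)
open import Data.Product using (∃; ∃₂; _×_; _,_; proj₁; proj₂)
open import Data.Sum using (_⊎_; inj₁; inj₂; [_,_]′)
open import Data.Unit using (tt)
open import Function using (_∘_)
open import Function.Bundles using (mk⇔)
open import Relation.Binary.Definitions using (tri<; tri≈; tri>)
open import Relation.Binary.PropositionalEquality
  using (_≡_; _≢_; refl; sym; trans; cong; cong₂; subst; module ≡-Reasoning)
import Relation.Binary.Reasoning.Setoid as SetoidReasoning
open import Relation.Nullary using (¬_; Dec; yes; no)
open import Relation.Nullary.Decidable using (dec⇒maybe)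

-- Power series over ℤ as a commutative ring

shift : PS → PS
shift f n = f (suc n)

scale : ℤ → PS → PS
scale c f n = c ℤ.* f n

⊖_ : PS → PS

(⊖ f) n = ℤ.- f n

0ₚ 1ₚ : PS
0ₚ = const (+ 0)

1ₚ = const (+ 1)

0ₚ-coeff : ∀ n → 0ₚ n ≡ + 0
0ₚ-coeff zero    = refl
0ₚ-coeff (suc n) = refl

map-upTo-suc : ∀ (h : ℕ → ℤ) n → map h (upTo (suc n)) ≡ h 0 ∷ map (h ∘ suc) (upTo n)
map-upTo-suc h n = cong (h 0 ∷_) (trans (map-applyUpTo suc h n) (sym (map-upTo (h ∘ suc) n)))

⊛-suc : ∀ f g n → (f ⊛ g) (suc n) ≡ f 0 ℤ.* g (suc n) ℤ.+ (shift f ⊛ g) n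
⊛-suc f g n = cong (foldr ℤ._+_ (+ 0)) (map-upTo-suc (λ i → f i ℤ.* g (suc n ∸ i)) (suc n))

⊛-cong : ∀ {f f′ g g′} → f ≐ f′ → g ≐ g′ → (f ⊛ g) ≐ (f′ ⊛ g′)
⊛-cong {f} {f′} {g} {g′} f≐f′ g≐g′ zero rewrite f≐f′ 0 | g≐g′ 0 = refl
⊛-cong {f} {f′} {g} {g′} f≐f′ g≐g′ (suc n)
  rewrite ⊛-suc f g n | ⊛-suc f′ g′ n | f≐f′ 0 | g≐g′ (suc n)
        | ⊛-cong (f≐f′ ∘ suc) g≐g′ n = refl

⊛-zeroˡ : ∀ f g → (∀ n → f n ≡ + 0) → ∀ n → (f ⊛ g) n ≡ + 0
⊛-zeroˡ f g f≐0 zero rewrite f≐0 0 = refl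
⊛-zeroˡ f g f≐0 (suc n) rewrite ⊛-suc f g n | f≐0 0 | ⊛-zeroˡ (shift f) g (f≐0 ∘ suc) n = refl

const-⊛ : ∀ c g n → (const c ⊛ g) n ≡ c ℤ.* g n
const-⊛ c g zero    = ℤ.+-identityʳ _
const-⊛ c g (suc n)
  rewrite ⊛-suc (const c) g n | ⊛-zeroˡ (shift (const c)) g (λ _ → refl) n
  = ℤ.+-identityʳ _

module _ where
  open +-*-Solver

  ⊛-scaleˡ : ∀ c f g n → (scale c f ⊛ g) n ≡ c ℤ.* (f ⊛ g) n
  ⊛-scaleˡ c f g zero =
    solve 3 (λ c a b → c :* a :* b :+ con (+ 0) := c :* (a :* b :+ con (+ 0))) refl c (f 0) (g 0)
  ⊛-scaleˡ c f g (suc n) rewrite ⊛-suc (scale c f) g n | ⊛-suc f g n | ⊛-scaleˡ c (shift f) g n =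
    solve 4 (λ c a b d → c :* a :* b :+ c :* d := c :* (a :* b :+ d)) refl c (f 0) (g (suc n)) ((shift f ⊛ g) n)

  ⊛-distribˡ : ∀ f g h n → (f ⊛ (g ⊕ h)) n ≡ (f ⊛ g) n ℤ.+ (f ⊛ h) n
  ⊛-distribˡ f g h zero =
    solve 3 (λ a b c → a :* (b :+ c) :+ con (+ 0) := (a :* b :+ con (+ 0)) :+ (a :* c :+ con (+ 0)))
      refl (f 0) (g 0) (h 0)
  ⊛-distribˡ f g h (suc n)
    rewrite ⊛-suc f (g ⊕ h) n | ⊛-suc f g n | ⊛-suc f h n | ⊛-distribˡ (shift f) g h n =
    solve 5 (λ a b c d e → a :* (b :+ c) :+ (d :+ e) := (a :* b :+ d) :+ (a :* c :+ e))
      refl (f 0) (g (suc n)) (h (suc n)) ((shift f ⊛ g) n) ((shift f ⊛ h) n)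

  ⊛-distribʳ : ∀ f g h n → ((g ⊕ h) ⊛ f) n ≡ (g ⊛ f) n ℤ.+ (h ⊛ f) n
  ⊛-distribʳ f g h zero =
    solve 3 (λ a b c → (b :+ c) :* a :+ con (+ 0) := (b :* a :+ con (+ 0)) :+ (c :* a :+ con (+ 0)))
      refl (f 0) (g 0) (h 0)
  ⊛-distribʳ f g h (suc n)
    rewrite ⊛-suc (g ⊕ h) f n | ⊛-suc g f n | ⊛-suc h f n | ⊛-distribʳ f (shift g) (shift h) n =
    solve 5 (λ a b c d e → (b :+ c) :* a :+ (d :+ e) := (b :* a :+ d) :+ (c :* a :+ e))
      refl (f (suc n)) (g 0) (h 0) ((shift g ⊛ f) n) ((shift h ⊛ f) n)

  ⊛-sucʳ : ∀ f g n → (f ⊛ g) (suc n) ≡ f (suc n) ℤ.* g 0 ℤ.+ (f ⊛ shift g) n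
  ⊛-sucʳ f g zero rewrite ⊛-suc f g 0 =
    solve 4 (λ a b c d → a :* b :+ (c :* d :+ con (+ 0)) := c :* d :+ (a :* b :+ con (+ 0)))
      refl (f 0) (g 1) (f 1) (g 0)
  ⊛-sucʳ f g (suc n)
    rewrite ⊛-suc f g (suc n) | ⊛-sucʳ (shift f) g n | ⊛-suc f (shift g) n =
    solve 4 (λ a b c d → a :+ (b :+ c) := b :+ (a :+ c))
      refl (f 0 ℤ.* g (suc (suc n))) (f (suc (suc n)) ℤ.* g 0) ((shift f ⊛ shift g) n) (+ 0)

  ⊛-comm : ∀ f g → (f ⊛ g) ≐ (g ⊛ f)
  ⊛-comm f g zero = cong (ℤ._+ + 0) (ℤ.*-comm (f 0) (g 0))
  ⊛-comm f g (suc n) rewrite ⊛-suc f g n | ⊛-sucʳ g f n | ⊛-comm (shift f) g n =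
    cong (ℤ._+ (g ⊛ shift f) n) (ℤ.*-comm (f 0) (g (suc n)))

  ⊛-assoc : ∀ f g h → ((f ⊛ g) ⊛ h) ≐ (f ⊛ (g ⊛ h))
  ⊛-assoc f g h zero =
    solve 3 (λ a b c → (a :* b :+ con (+ 0)) :* c :+ con (+ 0) := a :* (b :* c :+ con (+ 0)) :+ con (+ 0))
      refl (f 0) (g 0) (h 0)
  ⊛-assoc f g h (suc n)
    rewrite ⊛-suc (f ⊛ g) h n | ⊛-suc f (g ⊛ h) n | ⊛-suc g h n
          | ⊛-cong {shift (f ⊛ g)} {scale (f 0) (shift g) ⊕ (shift f ⊛ g)} {h} {h} (⊛-suc f g) (λ _ → refl) n
          | ⊛-distribʳ h (scale (f 0) (shift g)) (shift f ⊛ g) n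
          | ⊛-scaleˡ (f 0) (shift g) h n
          | ⊛-assoc (shift f) g h n =
    solve 5 (λ a b c d e → (a :* b :+ con (+ 0)) :* c :+ (a :* d :+ e) := a :* (b :* c :+ d) :+ e)
      refl (f 0) (g 0) (h (suc n)) ((shift g ⊛ h) n) ((shift f ⊛ (g ⊛ h)) n)

⊛-identityˡ : ∀ f → (1ₚ ⊛ f) ≐ f
⊛-identityˡ f n = trans (const-⊛ (+ 1) f n) (ℤ.*-identityˡ (f n))

PS-isCommutativeRing : IsCommutativeRing _≐_ _⊕_ _⊛_ ⊖_ 0ₚ 1ₚ
PS-isCommutativeRing = record
  { isRing = record
    { +-isAbelianGroup = record
      { isGroup = record
        { isMonoid = record
          { isSemigroup = record
            { isMagma = record
              { isEquivalence = record
                { refl = λ _ → refl ; sym = λ p → sym ∘ p ; trans = λ p q n → trans (p n) (q n) }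
              ; ∙-cong = λ p q n → cong₂ ℤ._+_ (p n) (q n) }
            ; assoc = λ f g h n → ℤ.+-assoc (f n) (g n) (h n) }
          ; identity = (λ f n → trans (cong (ℤ._+ f n) (0ₚ-coeff n)) (ℤ.+-identityˡ (f n)))
                     , (λ f n → trans (cong (λ z → f n ℤ.+ z) (0ₚ-coeff n)) (ℤ.+-identityʳ (f n))) }
        ; inverse = (λ f n → trans (ℤ.+-inverseˡ (f n)) (sym (0ₚ-coeff n)))
                  , (λ f n → trans (ℤ.+-inverseʳ (f n)) (sym (0ₚ-coeff n)))
        ; ⁻¹-cong = λ p n → cong ℤ.-_ (p n) }
      ; comm = λ f g n → ℤ.+-comm (f n) (g n) }
    ; *-cong = ⊛-cong
    ; *-assoc = ⊛-assoc
    ; *-identity = ⊛-identityˡ , λ f n → trans (⊛-comm f 1ₚ n) (⊛-identityˡ f n)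
    ; distrib = ⊛-distribˡ , ⊛-distribʳ }
  ; *-comm = ⊛-comm }

PS-commutativeRing : CommutativeRing _ _
PS-commutativeRing = record { isCommutativeRing = PS-isCommutativeRing }

const-homomorphism : ℤ.+-*-rawRing ACR.-Raw-AlmostCommutative⟶ ACR.fromCommutativeRing PS-commutativeRing
const-homomorphism = record
  { ⟦_⟧    = const
  ; +-homo = λ { a b zero → refl ; a b (suc n) → refl }
  ; *-homo = λ a b n → sym (trans (const-⊛ a (const b) n) (*-const a b n))
  ; -‿homo = λ { a zero → refl ; a (suc n) → refl }
  ; 0-homo = λ _ → refl
  ; 1-homo = λ _ → refl }
  where
  *-const : ∀ a b n → a ℤ.* const b n ≡ const (a ℤ.* b) n
  *-const a b zero    = refl
  *-const a b (suc n) = ℤ.*-zeroʳ a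

module PS-Solver = Algebra.Solver.Ring ℤ.+-*-rawRing (ACR.fromCommutativeRing PS-commutativeRing)
  const-homomorphism (λ a b → Maybe.map (λ a≡b n → cong (λ c → const c n) a≡b) (dec⇒maybe (a ℤ.≟ b)))

X-⊛-suc : ∀ f n → (X ⊛ f) (suc n) ≡ f n
X-⊛-suc f n = begin
  (X ⊛ f) (suc n)             ≡⟨ ⊛-suc X f n ⟩
  + 0 ℤ.+ (shift X ⊛ f) n     ≡⟨ ℤ.+-identityˡ _ ⟩
  (shift X ⊛ f) n             ≡⟨ ⊛-cong {g = f} shift-X≐1 (λ _ → refl) n ⟩
  (1ₚ ⊛ f) n                  ≡⟨ ⊛-identityˡ f n ⟩
  f n                         ∎
  where
  open ≡-Reasoning
  shift-X≐1 : shift X ≐ 1ₚ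
  shift-X≐1 zero    = refl
  shift-X≐1 (suc n) = refl

-- The reciprocal recurrence

denominator : PS → PS
denominator F = (1ₚ ⊕ (⊖ X)) ⊕ (⊖ ((X ⊛ X) ⊛ F))

module ChebyshevQuotient (F V : ℕ → PS)
  (F-equation : ∀ k → F (suc k) ≐ (1ₚ ⊕ ((X ⊛ F (suc k)) ⊕ ((X ⊛ X) ⊛ (F k ⊛ F (suc k))))))
  (V-recurrence : ∀ k → V (suc (suc k)) ≐ ((twoOneMinusX ⊛ V (suc k)) ⊕ (minusFourX² ⊛ V k)))
  (V-one : V 1 ≐ ((const (+ 2) ⊛ V 0) ⊛ denominator (F 0))) where

  open CommutativeRing PS-commutativeRing using (setoid; +-cong; +-congˡ; *-congˡ; -‿cong; *-identityʳ)
  open SetoidReasoning setoid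
  open PS-Solver using (solve; _:=_; _:+_; _:*_; :-_; _:-_; con)

  F-inverse : ∀ k → (F (suc k) ⊛ denominator (F k)) ≐ 1ₚ
  F-inverse k = begin
    F (suc k) ⊛ denominator (F k)
      ≈⟨ solve 3 (λ n n′ x → n′ :* ((con (+ 1) :+ (:- x)) :+ (:- ((x :* x) :* n)))
                          := n′ :- (x :* n′ :+ (x :* x) :* (n :* n′))) (λ _ → refl) (F k) (F (suc k)) X ⟩
    F (suc k) ⊕ (⊖ rest)
      ≈⟨ +-cong (F-equation k) (λ _ → refl) ⟩
    (1ₚ ⊕ rest) ⊕ (⊖ rest)
      ≈⟨ solve 2 (λ r x → (con (+ 1) :+ r) :- r := con (+ 1)) (λ _ → refl) rest X ⟩
    1ₚ ∎
    where
    rest : PS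
    rest = (X ⊛ F (suc k)) ⊕ ((X ⊛ X) ⊛ (F k ⊛ F (suc k)))

  V-step : ∀ k → V (suc k) ≐ ((const (+ 2) ⊛ V k) ⊛ denominator (F k))
  F⊛V : ∀ k → (F (suc k) ⊛ V (suc k)) ≐ (const (+ 2) ⊛ V k)

  F⊛V k = begin
    F (suc k) ⊛ V (suc k)
      ≈⟨ *-congˡ {F (suc k)} (V-step k) ⟩
    F (suc k) ⊛ ((const (+ 2) ⊛ V k) ⊛ denominator (F k))
      ≈⟨ solve 3 (λ n′ v d → n′ :* ((con (+ 2) :* v) :* d) := (con (+ 2) :* v) :* (n′ :* d))
           (λ _ → refl) (F (suc k)) (V k) (denominator (F k)) ⟩
    (const (+ 2) ⊛ V k) ⊛ (F (suc k) ⊛ denominator (F k))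
      ≈⟨ *-congˡ {const (+ 2) ⊛ V k} (F-inverse k) ⟩
    (const (+ 2) ⊛ V k) ⊛ 1ₚ
      ≈⟨ *-identityʳ _ ⟩
    const (+ 2) ⊛ V k ∎

  V-step zero    = V-one
  V-step (suc k) = begin
    V (suc (suc k))
      ≈⟨ V-recurrence k ⟩
    (twoOneMinusX ⊛ V (suc k)) ⊕ (minusFourX² ⊛ V k)
      ≈⟨ solve 3 (λ v′ v x → (con (+ 2) :+ con (ℤ.- + 2) :* x) :* v′ :+ (con (ℤ.- + 4) :* (x :* x)) :* v
                           := (con (+ 2) :* v′) :* (con (+ 1) :- x)
                              :- (con (+ 2) :* (x :* x)) :* (con (+ 2) :* v))
           (λ _ → refl) (V (suc k)) (V k) X ⟩
    ((const (+ 2) ⊛ V (suc k)) ⊛ (1ₚ ⊕ (⊖ X))) ⊕ (⊖ ((const (+ 2) ⊛ (X ⊛ X)) ⊛ (const (+ 2) ⊛ V k)))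
      ≈⟨ +-congˡ {(const (+ 2) ⊛ V (suc k)) ⊛ (1ₚ ⊕ (⊖ X))}
                (-‿cong (*-congˡ {const (+ 2) ⊛ (X ⊛ X)} (F⊛V k))) ⟨
    ((const (+ 2) ⊛ V (suc k)) ⊛ (1ₚ ⊕ (⊖ X))) ⊕ (⊖ ((const (+ 2) ⊛ (X ⊛ X)) ⊛ (F (suc k) ⊛ V (suc k))))
      ≈⟨ solve 3 (λ v′ n′ x → (con (+ 2) :* v′) :* (con (+ 1) :- x) :- (con (+ 2) :* (x :* x)) :* (n′ :* v′)
                            := (con (+ 2) :* v′) :* ((con (+ 1) :- x) :- (x :* x) :* n′))
           (λ _ → refl) (V (suc k)) (F (suc k)) X ⟩
    (const (+ 2) ⊛ V (suc k)) ⊛ denominator (F (suc k)) ∎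

  F⊛[X⊛V]≐twoX⊛V : ∀ k → (F (suc k) ⊛ (X ⊛ V (suc k))) ≐ (twoX ⊛ V k)
  F⊛[X⊛V]≐twoX⊛V k = begin
    F (suc k) ⊛ (X ⊛ V (suc k))
      ≈⟨ solve 3 (λ n′ x v′ → n′ :* (x :* v′) := x :* (n′ :* v′)) (λ _ → refl) (F (suc k)) X (V (suc k)) ⟩
    X ⊛ (F (suc k) ⊛ V (suc k))
      ≈⟨ *-congˡ {X} (F⊛V k) ⟩
    X ⊛ (const (+ 2) ⊛ V k)
      ≈⟨ solve 2 (λ x v → x :* (con (+ 2) :* v) := (con (+ 2) :* x) :* v) (λ _ → refl) X (V k) ⟩
    twoX ⊛ V k ∎

-- Boolean reflection, sublists and pattern containment

∧-true⁻ : ∀ {a b} → a ∧ b ≡ true → a ≡ true × b ≡ true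
∧-true⁻ {true} {true} _ = refl , refl

∧-true⁺ : ∀ {a b} → a ≡ true → b ≡ true → a ∧ b ≡ true
∧-true⁺ refl refl = refl

not-true⁻ : ∀ {a} → not a ≡ true → a ≡ false
not-true⁻ {false} _ = refl

==-true⁻ : ∀ {a b} → (a == b) ≡ true → a ≡ b
==-true⁻ {true}  {true}  _ = refl
==-true⁻ {false} {false} _ = refl

==-refl : ∀ a → (a == a) ≡ true
==-refl true  = refl
==-refl false = refl

<ᵇ-true⁻ : ∀ {a b} → (a <ᵇ b) ≡ true → a < b
<ᵇ-true⁻ {a} {b} e = ℕ.<ᵇ⇒< a b (subst T (sym e) tt)

<ᵇ-true⁺ : ∀ {a b} → a < b → (a <ᵇ b) ≡ true
<ᵇ-true⁺ {a} {b} a<b with a <ᵇ b | ℕ.<⇒<ᵇ a<b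
... | true | _ = refl

<ᵇ-false⁺ : ∀ {a b} → b ≤ a → (a <ᵇ b) ≡ false
<ᵇ-false⁺ {a} {b} b≤a with a <ᵇ b in eq
... | false = refl
... | true  = ⊥-elim (ℕ.<⇒≱ (<ᵇ-true⁻ eq) b≤a)

<ᵇ-false⁻ : ∀ {a b} → (a <ᵇ b) ≡ false → b ≤ a
<ᵇ-false⁻ {a} {b} e with ℕ.≤-<-connex b a
... | inj₁ b≤a = b≤a
... | inj₂ a<b with () ← trans (sym (<ᵇ-true⁺ a<b)) e

module _ {A : Set} (p : A → Bool) where

  any-true⁺ : ∀ {x xs} → x ∈ xs → p x ≡ true → any p xs ≡ true
  any-true⁺ {xs = y ∷ xs} (here refl) px rewrite px = refl
  any-true⁺ {xs = y ∷ xs} (there x∈xs) px rewrite any-true⁺ x∈xs px with p y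
  ... | true  = refl
  ... | false = refl

  any-true⁻ : ∀ xs → any p xs ≡ true → ∃ λ x → x ∈ xs × p x ≡ true
  any-true⁻ (y ∷ xs) e with p y in py
  ... | true  = y , here refl , py
  ... | false with x , x∈xs , px ← any-true⁻ xs e = x , there x∈xs , px

  any-false⁺ : ∀ xs → (∀ {x} → x ∈ xs → p x ≡ false) → any p xs ≡ false
  any-false⁺ []       h = refl
  any-false⁺ (y ∷ xs) h rewrite h (here refl) = any-false⁺ xs (h ∘ there)

  any-false⁻ : ∀ xs → any p xs ≡ false → ∀ {x} → x ∈ xs → p x ≡ false
  any-false⁻ xs e {x} x∈xs with p x in px
  ... | false = refl
  ... | true with () ← trans (sym (any-true⁺ x∈xs px)) e

  all-true⁺ : ∀ xs → (∀ {x} → x ∈ xs → p x ≡ true) → all p xs ≡ true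
  all-true⁺ []       h = refl
  all-true⁺ (y ∷ xs) h rewrite h (here refl) = all-true⁺ xs (h ∘ there)

  all-true⁻ : ∀ xs → all p xs ≡ true → ∀ {x} → x ∈ xs → p x ≡ true
  all-true⁻ (y ∷ xs) e (here refl)  = proj₁ (∧-true⁻ e)
  all-true⁻ (y ∷ xs) e (there x∈xs) = all-true⁻ xs (proj₂ (∧-true⁻ {p y} e)) x∈xs

  all-++ : ∀ xs ys → all p (xs ++ ys) ≡ all p xs ∧ all p ys
  all-++ []       ys = refl
  all-++ (x ∷ xs) ys rewrite all-++ xs ys with p x
  ... | true  = refl
  ... | false = refl

all-cong : ∀ {A : Set} {p q : A → Bool} → (∀ x → p x ≡ q x) → ∀ xs → all p xs ≡ all q xs
all-cong p≗q []       = refl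
all-cong p≗q (x ∷ xs) = cong₂ _∧_ (p≗q x) (all-cong p≗q xs)

⊆-++-split : ∀ {s} A B → s ⊆ A ++ B → ∃₂ λ s₁ s₂ → s ≡ s₁ ++ s₂ × s₁ ⊆ A × s₂ ⊆ B
⊆-++-split []      B p = [] , _ , refl , [] , p
⊆-++-split (x ∷ A) B (.x ∷ʳ p) with s₁ , s₂ , refl , q₁ , q₂ ← ⊆-++-split A B p =
  s₁ , s₂ , refl , x ∷ʳ q₁ , q₂
⊆-++-split (x ∷ A) B (refl ∷ p) with s₁ , s₂ , refl , q₁ , q₂ ← ⊆-++-split A B p =
  x ∷ s₁ , s₂ , refl , refl ∷ q₁ , q₂

⊆-prefix : ∀ u v A C → u ++ v ⊆ A ++ C → length C ≤ length v → u ⊆ A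
⊆-prefix []      v A       C p         _ = minimum A
⊆-prefix (x ∷ u) v []      C p         l =
  ⊥-elim (ℕ.<⇒≱ (s≤s v≤u++v) (ℕ.≤-trans (length-mono-≤ p) l))
  where
  v≤u++v : length v ≤ length (u ++ v)
  v≤u++v = subst (length v ≤_) (sym (length-++ u)) (ℕ.m≤n+m (length v) (length u))
⊆-prefix (x ∷ u) v (a ∷ A) C (.a ∷ʳ p) l = a ∷ʳ ⊆-prefix (x ∷ u) v A C p l
⊆-prefix (x ∷ u) v (a ∷ A) C (refl ∷ p) l = refl ∷ ⊆-prefix u v A C p l

Unique-resp-⊆ : ∀ {s π : List ℕ} → s ⊆ π → Unique π → Unique s
Unique-resp-⊆ []         []      = []
Unique-resp-⊆ (_ ∷ʳ p)   (_ ∷ u) = Unique-resp-⊆ p u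
Unique-resp-⊆ (refl ∷ p) (a ∷ u) = All-resp-⊆ p a ∷ Unique-resp-⊆ p u

∈-subseqs⁺ : ∀ {s π} → s ⊆ π → s ∈ subseqs π
∈-subseqs⁺ []                        = here refl
∈-subseqs⁺ {π = x ∷ xs} (.x ∷ʳ p)   = ∈-++⁺ʳ (map (x ∷_) (subseqs xs)) (∈-subseqs⁺ p)
∈-subseqs⁺ {π = x ∷ xs} (refl ∷ p) = ∈-++⁺ˡ (∈-map⁺ (x ∷_) (∈-subseqs⁺ p))

∈-subseqs⁻ : ∀ {s} π → s ∈ subseqs π → s ⊆ π
∈-subseqs⁻ []       (here refl) = []
∈-subseqs⁻ (x ∷ xs) s∈ with ∈-++⁻ (map (x ∷_) (subseqs xs)) s∈
... | inj₂ s∈′ = x ∷ʳ ∈-subseqs⁻ xs s∈′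
... | inj₁ s∈′ with t , t∈ , refl ← ∈-map⁻ (x ∷_) s∈′ = refl ∷ ∈-subseqs⁻ xs t∈

contains⁺ : ∀ {π σ s} → s ⊆ π → orderIso σ s ≡ true → contains π σ ≡ true
contains⁺ {σ = σ} p iso = any-true⁺ (orderIso σ) (∈-subseqs⁺ p) iso

contains⁻ : ∀ π σ → contains π σ ≡ true → ∃ λ s → s ⊆ π × orderIso σ s ≡ true
contains⁻ π σ c with s , s∈ , iso ← any-true⁻ (orderIso σ) (subseqs π) c = s , ∈-subseqs⁻ π s∈ , iso

avoids⁺ : ∀ π σ → (contains π σ ≡ true → ⊥) → avoids π σ ≡ true
avoids⁺ π σ h with contains π σ
... | false = refl
... | true  = ⊥-elim (h refl)

avoids⁻ : ∀ π σ → avoids π σ ≡ true → contains π σ ≡ true → ⊥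
avoids⁻ π σ a c with () ← trans (sym (cong not c)) a

avoids-resp-⊇ : ∀ {π π′} σ → π ⊆ π′ → avoids π′ σ ≡ true → avoids π σ ≡ true
avoids-resp-⊇ {π} {π′} σ π⊆π′ a = avoids⁺ π σ λ c →
  let s , s⊆π , iso = contains⁻ π σ c in avoids⁻ π′ σ a (contains⁺ {σ = σ} (⊆-trans s⊆π π⊆π′) iso)

∈-ʳ++⁻ : ∀ {x : ℕ} xs {ys} → x ∈ xs ʳ++ ys → x ∈ xs ⊎ x ∈ ys
∈-ʳ++⁻ xs {ys} x∈ with Any.reverseAcc⁻ ys xs x∈
... | inj₁ x∈ys = inj₂ x∈ys
... | inj₂ x∈xs = inj₁ x∈xs

∈-ʳ++⁺ˡ : ∀ {x : ℕ} xs {ys} → x ∈ xs → x ∈ xs ʳ++ ys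
∈-ʳ++⁺ˡ xs {ys} x∈ = Any.reverseAcc⁺ ys xs (inj₂ x∈)

-- orderIso in Defs tests each pair with a pattern-matching lambda, which is not definitionally equal
-- to agree; orderIso-∷ converts between the two.
agree : ℕ → ℕ → ℕ × ℕ → Bool
agree a b (x , y) = ((a <ᵇ x) == (b <ᵇ y)) ∧ ((x <ᵇ a) == (y <ᵇ b))

agree⁺ : ∀ a b x y → (a <ᵇ x) ≡ (b <ᵇ y) → (x <ᵇ a) ≡ (y <ᵇ b) → agree a b (x , y) ≡ true
agree⁺ a b x y e₁ e₂ rewrite e₁ | e₂ = ∧-true⁺ (==-refl (b <ᵇ y)) (==-refl (y <ᵇ b))

orderIso-∷ : ∀ a as b bs → orderIso (a ∷ as) (b ∷ bs) ≡ all (agree a b) (zip as bs) ∧ orderIso as bs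
orderIso-∷ a as b bs = cong (_∧ orderIso as bs) (all-cong (λ _ → refl) (zip as bs))

orderIso-∷⁻ : ∀ a as b bs → orderIso (a ∷ as) (b ∷ bs) ≡ true →
              all (agree a b) (zip as bs) ≡ true × orderIso as bs ≡ true
orderIso-∷⁻ a as b bs iso = ∧-true⁻ (trans (sym (orderIso-∷ a as b bs)) iso)

orderIso-∷⁺ : ∀ a as b bs → all (agree a b) (zip as bs) ≡ true → orderIso as bs ≡ true →
              orderIso (a ∷ as) (b ∷ bs) ≡ true
orderIso-∷⁺ a as b bs h t = trans (orderIso-∷ a as b bs) (∧-true⁺ h t)

orderIso-head : ∀ a as b bs → orderIso (a ∷ as) (b ∷ bs) ≡ true → ∀ {x y} → (x , y) ∈ zip as bs →
                ((a <ᵇ x) ≡ (b <ᵇ y)) × ((x <ᵇ a) ≡ (y <ᵇ b))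
orderIso-head a as b bs iso xy∈ =
  let h₁ , h₂ = ∧-true⁻ (all-true⁻ (agree a b) (zip as bs) (proj₁ (orderIso-∷⁻ a as b bs iso)) xy∈)
  in ==-true⁻ h₁ , ==-true⁻ h₂

orderIso⇒length≡ : ∀ σ s → orderIso σ s ≡ true → length σ ≡ length s
orderIso⇒length≡ []       []       _   = refl
orderIso⇒length≡ (a ∷ as) (b ∷ bs) iso = cong suc (orderIso⇒length≡ as bs (proj₂ (orderIso-∷⁻ a as b bs iso)))

zip-++ : ∀ (xs ys xs′ ys′ : List ℕ) → length xs ≡ length ys →
         zip (xs ++ xs′) (ys ++ ys′) ≡ zip xs ys ++ zip xs′ ys′
zip-++ []       []       xs′ ys′ _ = refl
zip-++ (x ∷ xs) (y ∷ ys) xs′ ys′ e = cong ((x , y) ∷_) (zip-++ xs ys xs′ ys′ (ℕ.suc-injective e))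

∈-zip⁻ : ∀ {x y : ℕ} xs ys → (x , y) ∈ zip xs ys → x ∈ xs × y ∈ ys
∈-zip⁻ (a ∷ xs) (b ∷ ys) (here refl) = here refl , here refl
∈-zip⁻ (a ∷ xs) (b ∷ ys) (there xy∈) with x∈ , y∈ ← ∈-zip⁻ xs ys xy∈ = there x∈ , there y∈

PreservesOrder : (ℕ → ℕ) → Set
PreservesOrder f = ∀ a b → (f a <ᵇ f b) ≡ (a <ᵇ b)

id-preservesOrder : PreservesOrder (λ x → x)
id-preservesOrder a b = refl

suc-preservesOrder : PreservesOrder suc
suc-preservesOrder a b = refl

+-preservesOrder : ∀ c → PreservesOrder (_+ c)
+-preservesOrder zero    a b rewrite ℕ.+-identityʳ a | ℕ.+-identityʳ b = refl
+-preservesOrder (suc c) a b rewrite ℕ.+-suc a c | ℕ.+-suc b c = +-preservesOrder c a b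

orderIso-map : ∀ f g → PreservesOrder f → PreservesOrder g →
               ∀ σ s → orderIso (map f σ) (map g s) ≡ orderIso σ s
orderIso-map f g pf pg []      []      = refl
orderIso-map f g pf pg []      (_ ∷ _) = refl
orderIso-map f g pf pg (_ ∷ _) []      = refl
orderIso-map f g pf pg (a ∷ σ) (b ∷ s) = begin
  orderIso (f a ∷ map f σ) (g b ∷ map g s)
    ≡⟨ orderIso-∷ (f a) (map f σ) (g b) (map g s) ⟩
  all (agree (f a) (g b)) (zip (map f σ) (map g s)) ∧ orderIso (map f σ) (map g s)
    ≡⟨ cong₂ _∧_ (all-agree-map σ s) (orderIso-map f g pf pg σ s) ⟩
  all (agree a b) (zip σ s) ∧ orderIso σ s
    ≡⟨ orderIso-∷ a σ b s ⟨
  orderIso (a ∷ σ) (b ∷ s) ∎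
  where
  open ≡-Reasoning
  all-agree-map : ∀ xs ys → all (agree (f a) (g b)) (zip (map f xs) (map g ys)) ≡ all (agree a b) (zip xs ys)
  all-agree-map []       _        = refl
  all-agree-map (_ ∷ _)  []       = refl
  all-agree-map (x ∷ xs) (y ∷ ys) =
    cong₂ _∧_ (cong₂ _∧_ (cong₂ _==_ (pf a x) (pg b y)) (cong₂ _==_ (pf x a) (pg y b))) (all-agree-map xs ys)

orderIso-mapˡ : ∀ f → PreservesOrder f → ∀ σ s → orderIso (map f σ) s ≡ orderIso σ s
orderIso-mapˡ f pf σ s =
  trans (cong (orderIso (map f σ)) (sym (map-id s))) (orderIso-map f (λ x → x) pf id-preservesOrder σ s)

orderIso-mapʳ : ∀ g → PreservesOrder g → ∀ σ s → orderIso σ (map g s) ≡ orderIso σ s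
orderIso-mapʳ g pg σ s =
  trans (cong (λ τ → orderIso τ (map g s)) (sym (map-id σ))) (orderIso-map (λ x → x) g id-preservesOrder pg σ s)

orderIso-++⁻ : ∀ p q s → orderIso (p ++ q) s ≡ true →
               ∃₂ λ u v → s ≡ u ++ v × orderIso p u ≡ true × orderIso q v ≡ true
orderIso-++⁻ []      q s       iso = [] , s , refl , refl , iso
orderIso-++⁻ (a ∷ p) q (b ∷ s) iso
  with h , t ← orderIso-∷⁻ a (p ++ q) b s iso
  with u , v , refl , pu , qv ← orderIso-++⁻ p q s t
  rewrite zip-++ p u q v (orderIso⇒length≡ p u pu) | all-++ (agree a b) (zip p u) (zip q v)
  = b ∷ u , v , refl , orderIso-∷⁺ a p b u (proj₁ (∧-true⁻ h)) pu , qv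

orderIso-++⁺ : ∀ p q u v → orderIso p u ≡ true → orderIso q v ≡ true →
               (∀ {x y x′ y′} → (x , y) ∈ zip p u → (x′ , y′) ∈ zip q v → agree x y (x′ , y′) ≡ true) →
               orderIso (p ++ q) (u ++ v) ≡ true
orderIso-++⁺ []      q []      v _  qv _     = qv
orderIso-++⁺ (a ∷ p) q (b ∷ u) v pu qv cross with h , t ← orderIso-∷⁻ a p b u pu =
  orderIso-∷⁺ a (p ++ q) b (u ++ v) head (orderIso-++⁺ p q u v t qv (cross ∘ there))
  where
  head : all (agree a b) (zip (p ++ q) (u ++ v)) ≡ true
  head = begin
    all (agree a b) (zip (p ++ q) (u ++ v))
      ≡⟨ cong (all (agree a b)) (zip-++ p u q v (orderIso⇒length≡ p u t)) ⟩
    all (agree a b) (zip p u ++ zip q v)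
      ≡⟨ all-++ (agree a b) (zip p u) (zip q v) ⟩
    all (agree a b) (zip p u) ∧ all (agree a b) (zip q v)
      ≡⟨ ∧-true⁺ h (all-true⁺ (agree a b) (zip q v) (cross (here refl))) ⟩
    true ∎
    where open ≡-Reasoning

orderIso-first-last : ∀ a p c b u d → orderIso (a ∷ p ++ [ c ]) (b ∷ u ++ [ d ]) ≡ true →
                      (a <ᵇ c) ≡ (b <ᵇ d)
orderIso-first-last a p c b u d iso =
  proj₁ (orderIso-head a (p ++ [ c ]) b (u ++ [ d ]) iso
          (subst ((c , d) ∈_) (sym (zip-++ p u [ c ] [ d ] p≡u)) (∈-++⁺ʳ (zip p u) (here refl))))
  where
  p≡u : length p ≡ length u
  p≡u = ℕ.+-cancelʳ-≡ 1 _ _ (begin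
    length p + 1       ≡⟨ length-++ p ⟨
    length (p ++ [ c ]) ≡⟨ ℕ.suc-injective (orderIso⇒length≡ (a ∷ p ++ [ c ]) (b ∷ u ++ [ d ]) iso) ⟩
    length (u ++ [ d ]) ≡⟨ length-++ u ⟩
    length u + 1       ∎)
    where open ≡-Reasoning

FirstBelowLast : List ℕ → Set
FirstBelowLast σ = ∃₂ λ a p → ∃ λ c → σ ≡ a ∷ p ++ [ c ] × a < c

skew-sum-occurrence : ∀ {σ} → FirstBelowLast σ → ∀ {s} X B → orderIso σ s ≡ true → s ⊆ X ++ B →
                      (∀ {x y} → x ∈ X → y ∈ B → y < x) → s ⊆ X ⊎ s ⊆ B
skew-sum-occurrence (a , p , c , refl , a<c) X B iso s⊆ B<X with ⊆-++-split X B s⊆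
... | [] , s₂ , refl , _ , s₂⊆B = inj₂ s₂⊆B
... | x ∷ s₁ , s₂ , refl , s₁⊆X , s₂⊆B with initLast s₂
...   | [] rewrite ++-identityʳ (x ∷ s₁) = inj₁ s₁⊆X
...   | s₂′ ∷ʳ′ y = ⊥-elim (ℕ.<-asym y<x x<y)
  where
  y<x : y < x
  y<x = B<X (lookup s₁⊆X (here refl)) (lookup s₂⊆B (∈-++⁺ʳ s₂′ (here refl)))
  x<y : x < y
  x<y = <ᵇ-true⁻ (trans (sym (orderIso-first-last a p c x (s₁ ++ s₂′) y
          (subst (λ t → orderIso (a ∷ p ++ [ c ]) (x ∷ t) ≡ true) (sym (++-assoc s₁ s₂′ [ y ])) iso)))
          (<ᵇ-true⁺ a<c))

any-map : ∀ {A B : Set} (p : B → Bool) (h : A → B) xs → any p (map h xs) ≡ any (p ∘ h) xs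
any-map p h xs = cong (foldr _∨_ false) (sym (map-∘ xs))

any-cong : ∀ {A : Set} {p q : A → Bool} → (∀ x → p x ≡ q x) → ∀ xs → any p xs ≡ any q xs
any-cong p≗q []       = refl
any-cong p≗q (x ∷ xs) = cong₂ _∨_ (p≗q x) (any-cong p≗q xs)

subseqs-map : ∀ (f : ℕ → ℕ) xs → subseqs (map f xs) ≡ map (map f) (subseqs xs)
subseqs-map f []       = refl
subseqs-map f (x ∷ xs) = begin
  map (f x ∷_) (subseqs (map f xs)) ++ subseqs (map f xs)
    ≡⟨ cong (λ S → map (f x ∷_) S ++ S) (subseqs-map f xs) ⟩
  map (f x ∷_) (map (map f) (subseqs xs)) ++ map (map f) (subseqs xs)
    ≡⟨ cong (_++ map (map f) (subseqs xs)) (trans (sym (map-∘ (subseqs xs))) (map-∘ (subseqs xs))) ⟩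
  map (map f) (map (x ∷_) (subseqs xs)) ++ map (map f) (subseqs xs)
    ≡⟨ map-++ (map f) (map (x ∷_) (subseqs xs)) (subseqs xs) ⟨
  map (map f) (map (x ∷_) (subseqs xs) ++ subseqs xs) ∎
  where open ≡-Reasoning

contains-map : ∀ f → PreservesOrder f → ∀ π σ → contains (map f π) σ ≡ contains π σ
contains-map f pf π σ = begin
  any (orderIso σ) (subseqs (map f π))        ≡⟨ cong (any (orderIso σ)) (subseqs-map f π) ⟩
  any (orderIso σ) (map (map f) (subseqs π))  ≡⟨ any-map (orderIso σ) (map f) (subseqs π) ⟩
  any (orderIso σ ∘ map f) (subseqs π)        ≡⟨ any-cong (orderIso-mapʳ f pf σ) (subseqs π) ⟩
  any (orderIso σ) (subseqs π)                ∎
  where open ≡-Reasoning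

FirstBelowLast⇒2≤length : ∀ {σ} → FirstBelowLast σ → 2 ≤ length σ
FirstBelowLast⇒2≤length (a , p , c , refl , _)
  rewrite length-++ p {[ c ]} | ℕ.+-comm (length p) 1 = s≤s (s≤s z≤n)

contains-max∷⁻ : ∀ {σ} → FirstBelowLast σ → ∀ {M B} → (∀ {y} → y ∈ B → y < M) →
                 contains (M ∷ B) σ ≡ true → contains B σ ≡ true
contains-max∷⁻ {σ} fbl {M} {B} B<M c with s , s⊆ , iso ← contains⁻ (M ∷ B) σ c
  with skew-sum-occurrence fbl [ M ] B iso s⊆ (λ { (here refl) → B<M })
... | inj₂ s⊆B = contains⁺ {σ = σ} s⊆B iso
... | inj₁ s⊆M = ⊥-elim (ℕ.<⇒≱ 2≤|s| (length-mono-≤ s⊆M))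
  where
  2≤|s| : 2 ≤ length s
  2≤|s| = ℕ.≤-trans (FirstBelowLast⇒2≤length fbl) (ℕ.≤-reflexive (orderIso⇒length≡ σ s iso))

⊆-++-last : ∀ {s y} A C → s ++ [ y ] ⊆ A ++ C → y ∉ C → s ++ [ y ] ⊆ A
⊆-++-last {s} {y} A C s⊆ y∉C with s₁ , s₂ , eq , s₁⊆A , s₂⊆C ← ⊆-++-split A C s⊆ | initLast s₂
... | []        rewrite ++-identityʳ s₁ | eq = s₁⊆A
... | s₂′ ∷ʳ′ y′ with refl ← proj₂ (∷ʳ-injective s (s₁ ++ s₂′) (trans eq (sym (++-assoc s₁ s₂′ [ y′ ])))) =
  ⊥-elim (y∉C (lookup s₂⊆C (∈-++⁺ʳ s₂′ (here refl))))

p132 : List ℕ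
p132 = 1 ∷ 3 ∷ 2 ∷ []

FirstBelowLast-p132 : FirstBelowLast p132
FirstBelowLast-p132 = 1 , [ 3 ] , 2 , refl , s≤s (s≤s z≤n)

orderIso-p132⁻ : ∀ x z y → orderIso p132 (x ∷ z ∷ y ∷ []) ≡ true → x < z × x < y × y < z
orderIso-p132⁻ x z y iso =
  <ᵇ-true⁻ (sym (proj₁ (orderIso-head 1 (3 ∷ 2 ∷ []) x (z ∷ y ∷ []) iso (here refl)))) ,
  <ᵇ-true⁻ (sym (proj₁ (orderIso-head 1 (3 ∷ 2 ∷ []) x (z ∷ y ∷ []) iso (there (here refl))))) ,
  <ᵇ-true⁻ (sym (proj₂ (orderIso-head 3 [ 2 ] z [ y ]
                          (proj₂ (orderIso-∷⁻ 1 (3 ∷ 2 ∷ []) x (z ∷ y ∷ []) iso)) (here refl))))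

orderIso-p132⁺ : ∀ {x z y} → x < z → x < y → y < z → orderIso p132 (x ∷ z ∷ y ∷ []) ≡ true
orderIso-p132⁺ x<z x<y y<z
  rewrite <ᵇ-true⁺ x<z | <ᵇ-true⁺ x<y | <ᵇ-true⁺ y<z
        | <ᵇ-false⁺ (ℕ.<⇒≤ x<z) | <ᵇ-false⁺ (ℕ.<⇒≤ x<y) | <ᵇ-false⁺ (ℕ.<⇒≤ y<z) = refl

extend : ℕ → List ℕ → List ℕ
extend L τ = map suc τ ++ 1 ∷ [ L ]

FirstBelowLast-extend : ∀ {L τ} → 1 < L → (∀ {p} → p ∈ τ → suc p < L) → FirstBelowLast (extend L τ)
FirstBelowLast-extend {L} {[]}     1<L _        = 1 , [] , L , refl , 1<L
FirstBelowLast-extend {L} {t ∷ ts} _   τ-bounds =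
  suc t , map suc ts ++ [ 1 ] , L , cong (suc t ∷_) (sym (++-assoc (map suc ts) [ 1 ] [ L ])) ,
  τ-bounds (here refl)

-- The Motzkin condition

noRise-pre-cong : ∀ pre pre′ ys → (∀ {y} → y ∈ ys → any (_<ᵇ y) pre ≡ any (_<ᵇ y) pre′) →
                  noRiseAfterSmaller pre ys ≡ noRiseAfterSmaller pre′ ys
noRise-pre-cong pre pre′ []           h = refl
noRise-pre-cong pre pre′ (y ∷ [])     h = refl
noRise-pre-cong pre pre′ (y ∷ z ∷ zs) h =
  cong₂ _∧_ (cong (λ b → not ((y <ᵇ z) ∧ b)) (h (here refl)))
            (noRise-pre-cong (y ∷ pre) (y ∷ pre′) (z ∷ zs) (λ {w} w∈ → cong ((y <ᵇ w) ∨_) (h (there w∈))))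

noRise-++⁻ˡ : ∀ pre xs ys → noRiseAfterSmaller pre (xs ++ ys) ≡ true → noRiseAfterSmaller pre xs ≡ true
noRise-++⁻ˡ pre []           ys _ = refl
noRise-++⁻ˡ pre (x ∷ [])     ys _ = refl
noRise-++⁻ˡ pre (x ∷ x′ ∷ xs) ys e =
  let h , t = ∧-true⁻ {not ((x <ᵇ x′) ∧ any (_<ᵇ x) pre)} e
  in ∧-true⁺ h (noRise-++⁻ˡ (x ∷ pre) (x′ ∷ xs) ys t)

noRise-++⁻ʳ : ∀ pre xs ys → noRiseAfterSmaller pre (xs ++ ys) ≡ true →
              noRiseAfterSmaller (xs ʳ++ pre) ys ≡ true
noRise-++⁻ʳ pre []            ys       e = e
noRise-++⁻ʳ pre (x ∷ [])      []       e = refl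
noRise-++⁻ʳ pre (x ∷ [])      (y ∷ ys) e = proj₂ (∧-true⁻ {not ((x <ᵇ y) ∧ any (_<ᵇ x) pre)} e)
noRise-++⁻ʳ pre (x ∷ x′ ∷ xs) ys       e =
  noRise-++⁻ʳ (x ∷ pre) (x′ ∷ xs) ys (proj₂ (∧-true⁻ {not ((x <ᵇ x′) ∧ any (_<ᵇ x) pre)} e))

noRise-++⁺ : ∀ pre xs y ys → noRiseAfterSmaller pre (xs ++ [ y ]) ≡ true →
             noRiseAfterSmaller (xs ʳ++ pre) (y ∷ ys) ≡ true → noRiseAfterSmaller pre (xs ++ y ∷ ys) ≡ true
noRise-++⁺ pre []            y ys e₁ e₂ = e₂
noRise-++⁺ pre (x ∷ [])      y ys e₁ e₂ = ∧-true⁺ (proj₁ (∧-true⁻ {not ((x <ᵇ y) ∧ any (_<ᵇ x) pre)} e₁)) e₂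
noRise-++⁺ pre (x ∷ x′ ∷ xs) y ys e₁ e₂ =
  let h , t = ∧-true⁻ {not ((x <ᵇ x′) ∧ any (_<ᵇ x) pre)} e₁
  in ∧-true⁺ h (noRise-++⁺ (x ∷ pre) (x′ ∷ xs) y ys t e₂)

noRise-∷ʳ-max : ∀ pre xs M → (∀ {x} → x ∈ xs → (x <ᵇ M) ≡ false) →
                noRiseAfterSmaller pre xs ≡ true → noRiseAfterSmaller pre (xs ++ [ M ]) ≡ true
noRise-∷ʳ-max pre []            M h e = refl
noRise-∷ʳ-max pre (x ∷ [])      M h e rewrite h (here refl) = refl
noRise-∷ʳ-max pre (x ∷ x′ ∷ xs) M h e =
  let h′ , t = ∧-true⁻ {not ((x <ᵇ x′) ∧ any (_<ᵇ x) pre)} e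
  in ∧-true⁺ h′ (noRise-∷ʳ-max (x ∷ pre) (x′ ∷ xs) M (h ∘ there) t)

noRise-map : ∀ f → PreservesOrder f → ∀ pre xs →
             noRiseAfterSmaller (map f pre) (map f xs) ≡ noRiseAfterSmaller pre xs
noRise-map f pf pre []            = refl
noRise-map f pf pre (x ∷ [])      = refl
noRise-map f pf pre (x ∷ x′ ∷ xs) =
  cong₂ _∧_ (cong₂ (λ a b → not (a ∧ b)) (pf x x′) (any-below-map pre))
            (noRise-map f pf (x ∷ pre) (x′ ∷ xs))
  where
  any-below-map : ∀ pre → any (_<ᵇ f x) (map f pre) ≡ any (_<ᵇ x) pre
  any-below-map []      = refl
  any-below-map (p ∷ pre) = cong₂ _∨_ (pf p x) (any-below-map pre)

noRise-pre-above : ∀ pre ys → (∀ {y p} → y ∈ ys → p ∈ pre → y < p) →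
                   noRiseAfterSmaller pre ys ≡ noRiseAfterSmaller [] ys
noRise-pre-above pre ys ys<pre = noRise-pre-cong pre [] ys λ y∈ →
  any-false⁺ _ pre (λ p∈ → <ᵇ-false⁺ (ℕ.<⇒≤ (ys<pre y∈ p∈)))

noRise-max∷ : ∀ pre M B → (∀ {y} → y ∈ B → y < M) → (∀ {y p} → y ∈ B → p ∈ pre → y < p) →
              noRiseAfterSmaller pre (M ∷ B) ≡ noRiseAfterSmaller [] B
noRise-max∷ pre M []      _   _      = refl
noRise-max∷ pre M (b ∷ B) B<M B<pre rewrite <ᵇ-false⁺ {M} {b} (ℕ.<⇒≤ (B<M (here refl))) =
  noRise-pre-above (M ∷ pre) (b ∷ B) λ { y∈ (here refl) → B<M y∈ ; y∈ (there p∈) → B<pre y∈ p∈ }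

-- Duplicate-free lists and permutations

length-≡-from-∈ : ∀ {A : Set} {xs ys : List A} → Unique xs → Unique ys →
                  (∀ {z} → z ∈ xs → z ∈ ys) → (∀ {z} → z ∈ ys → z ∈ xs) → length xs ≡ length ys
length-≡-from-∈ ux uy to from = ↭-length (∼bag⇒↭ (unique∧set⇒bag ux uy (mk⇔ to from)))

concatMap-unique : ∀ {A B : Set} (f : A → List B) xs → Unique xs → (∀ {x} → x ∈ xs → Unique (f x)) →
                   (∀ {x y z} → x ∈ xs → y ∈ xs → z ∈ f x → z ∈ f y → x ≡ y) → Unique (concatMap f xs)
concatMap-unique f []       _          _   _     = []
concatMap-unique f (x ∷ xs) (x∉ ∷ uxs) ufx fdisj =
  Unique.++⁺ (ufx (here refl))
             (concatMap-unique f xs uxs (ufx ∘ there) (λ x∈ y∈ → fdisj (there x∈) (there y∈)))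
             λ (z∈fx , z∈rest) → let y , y∈xs , z∈fy = find (∈-concatMap⁻ f z∈rest)
                                 in All.lookup x∉ y∈xs (fdisj (here refl) (there y∈xs) z∈fx z∈fy)

++∷-cancel : ∀ {M : ℕ} xs ys xs′ ys′ → xs ++ M ∷ ys ≡ xs′ ++ M ∷ ys′ → M ∉ xs → M ∉ xs′ →
             xs ≡ xs′ × ys ≡ ys′
++∷-cancel []       ys []        ys′ refl _ _ = refl , refl
++∷-cancel []       ys (x′ ∷ xs′) ys′ refl _ M∉ = ⊥-elim (M∉ (here refl))
++∷-cancel (x ∷ xs) ys []        ys′ refl M∉ _ = ⊥-elim (M∉ (here refl))
++∷-cancel (x ∷ xs) ys (x′ ∷ xs′) ys′ eq M∉ M∉′ with refl , eq′ ← ∷-injective eq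
  with refl , refl ← ++∷-cancel xs ys xs′ ys′ eq′ (M∉ ∘ there) (M∉′ ∘ there) = refl , refl

∈-++∷⁻ : ∀ {z x : ℕ} a b → z ∈ a ++ x ∷ b → z ≡ x ⊎ z ∈ a ++ b
∈-++∷⁻ []      b (here e)  = inj₁ e
∈-++∷⁻ []      b (there m) = inj₂ m
∈-++∷⁻ (y ∷ a) b (here e)  = inj₂ (here e)
∈-++∷⁻ (y ∷ a) b (there m) with ∈-++∷⁻ a b m
... | inj₁ e  = inj₁ e
... | inj₂ m′ = inj₂ (there m′)

∈-++∷⁺ : ∀ {z x : ℕ} a b → z ∈ a ++ b → z ∈ a ++ x ∷ b
∈-++∷⁺ []      b m         = there m
∈-++∷⁺ (y ∷ a) b (here e)  = here e
∈-++∷⁺ (y ∷ a) b (there m) = there (∈-++∷⁺ a b m)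

All-++∷⁺ : ∀ {P : ℕ → Set} {x} a b → All P (a ++ b) → P x → All P (a ++ x ∷ b)
All-++∷⁺ []      b ps       px = px ∷ ps
All-++∷⁺ (y ∷ a) b (py ∷ ps) px = py ∷ All-++∷⁺ a b ps px

Unique-++∷⁺ : ∀ {x : ℕ} a b → Unique (a ++ b) → x ∉ a ++ b → Unique (a ++ x ∷ b)
Unique-++∷⁺ []      b u         x∉ = ¬Any⇒All¬ b x∉ ∷ u
Unique-++∷⁺ (y ∷ a) b (y∉ ∷ u) x∉ =
  All-++∷⁺ a b y∉ (λ y≡x → x∉ (here (sym y≡x))) ∷ Unique-++∷⁺ a b u (x∉ ∘ there)

Unique-++∷⁻ : ∀ {x : ℕ} a b → Unique (a ++ x ∷ b) → Unique (a ++ b) × x ∉ a ++ b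
Unique-++∷⁻ {x} a b u = Unique-resp-⊆ (++⁺ (⊆-refl {a}) (x ∷ʳ ⊆-refl)) u , x∉ a b u
  where
  x∉ : ∀ a b → Unique (a ++ x ∷ b) → x ∉ a ++ b
  x∉ []      b (x∉b ∷ _) x∈b       = All.lookup x∉b x∈b refl
  x∉ (y ∷ a) b (y∉ ∷ _)  (here refl) = All.lookup y∉ (∈-insert a) refl
  x∉ (y ∷ a) b (_ ∷ u)   (there x∈) = x∉ a b u x∈

Unique-++⁻-disjoint : ∀ {x : ℕ} xs ys → Unique (xs ++ ys) → x ∈ xs → x ∉ ys
Unique-++⁻-disjoint (y ∷ xs) ys (y∉ ∷ _) (here refl) x∈ys = All.lookup y∉ (∈-++⁺ʳ xs x∈ys) refl
Unique-++⁻-disjoint (y ∷ xs) ys (_ ∷ u)  (there x∈)  x∈ys = Unique-++⁻-disjoint xs ys u x∈ x∈ys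

∈-insertions⁻ : ∀ {π} x τ → π ∈ insertions x τ → ∃₂ λ a b → π ≡ a ++ x ∷ b × τ ≡ a ++ b
∈-insertions⁻ x []       (here refl) = [] , [] , refl , refl
∈-insertions⁻ x (y ∷ ys) (here refl) = [] , y ∷ ys , refl , refl
∈-insertions⁻ x (y ∷ ys) (there π∈) with _ , π′∈ , refl ← ∈-map⁻ (y ∷_) π∈
  with a , b , refl , refl ← ∈-insertions⁻ x ys π′∈ = y ∷ a , b , refl , refl

∈-insertions⁺ : ∀ x a b → a ++ x ∷ b ∈ insertions x (a ++ b)
∈-insertions⁺ x []      []      = here refl
∈-insertions⁺ x []      (y ∷ b) = here refl
∈-insertions⁺ x (y ∷ a) b       = there (∈-map⁺ (y ∷_) (∈-insertions⁺ x a b))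

insertions-unique : ∀ x τ → x ∉ τ → Unique (insertions x τ)
insertions-unique x []       _  = [] ∷ []
insertions-unique x (y ∷ ys) x∉ =
  All.tabulate head-new ∷ Unique.map⁺ (proj₂ ∘ ∷-injective) (insertions-unique x ys (x∉ ∘ there))
  where
  head-new : ∀ {π} → π ∈ map (y ∷_) (insertions x ys) → x ∷ y ∷ ys ≢ π
  head-new π∈ refl with _ , _ , e ← ∈-map⁻ (y ∷_) π∈ = x∉ (here (proj₁ (∷-injective e)))

insertions-disjoint : ∀ {π} x τ τ′ → x ∉ τ → x ∉ τ′ → π ∈ insertions x τ → π ∈ insertions x τ′ → τ ≡ τ′
insertions-disjoint x τ τ′ x∉τ x∉τ′ π∈ π∈′
  with a , b , refl , refl ← ∈-insertions⁻ x τ π∈ | a′ , b′ , eq , refl ← ∈-insertions⁻ x τ′ π∈′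
  with refl , refl ← ++∷-cancel a b a′ b′ eq (x∉τ ∘ ∈-++⁺ˡ) (x∉τ′ ∘ ∈-++⁺ˡ) = refl

record IsPermutation (n : ℕ) (π : List ℕ) : Set where
  field
    unique   : Unique π
    bounded  : ∀ {x} → x ∈ π → 1 ≤ x × x ≤ n
    complete : ∀ {x} → 1 ≤ x → x ≤ n → x ∈ π

module _ {n : ℕ} (a b : List ℕ) where

  IsPermutation-++∷⁺ : IsPermutation n (a ++ b) → IsPermutation (suc n) (a ++ suc n ∷ b)
  IsPermutation-++∷⁺ p = record
    { unique   = Unique-++∷⁺ a b unique (λ n+1∈ → ℕ.<-irrefl refl (proj₂ (bounded n+1∈)))
    ; bounded  = λ x∈ → [ (λ { refl → s≤s z≤n , ℕ.≤-refl })
                        , (λ x∈′ → proj₁ (bounded x∈′) , ℕ.m≤n⇒m≤1+n (proj₂ (bounded x∈′))) ]′ (∈-++∷⁻ a b x∈)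
    ; complete = complete′ }
    where
    open IsPermutation p
    complete′ : ∀ {x} → 1 ≤ x → x ≤ suc n → x ∈ a ++ suc n ∷ b
    complete′ {x} 1≤x x≤n+1 with x ℕ.≟ suc n
    ... | yes refl = ∈-insert a
    ... | no  x≢   = ∈-++∷⁺ a b (complete 1≤x (ℕ.≤-pred (ℕ.≤∧≢⇒< x≤n+1 x≢)))

  IsPermutation-++∷⁻ : IsPermutation (suc n) (a ++ suc n ∷ b) → IsPermutation n (a ++ b)
  IsPermutation-++∷⁻ p = record
    { unique   = proj₁ (Unique-++∷⁻ a b unique)
    ; bounded  = λ x∈ → proj₁ (bounded (∈-++∷⁺ a b x∈))
                      , ℕ.≤-pred (ℕ.≤∧≢⇒< (proj₂ (bounded (∈-++∷⁺ a b x∈))) (λ { refl → n+1∉ x∈ }))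
    ; complete = λ 1≤x x≤n → [ (λ { refl → ⊥-elim (ℕ.<-irrefl refl x≤n) }) , (λ x∈ → x∈) ]′
                               (∈-++∷⁻ a b (complete 1≤x (ℕ.m≤n⇒m≤1+n x≤n))) }
    where
    open IsPermutation p
    n+1∉ : suc n ∉ a ++ b
    n+1∉ = proj₂ (Unique-++∷⁻ a b unique)

∈-perms⁻ : ∀ n {π} → π ∈ perms n → IsPermutation n π
∈-perms⁻ zero    (here refl) = record
  { unique = [] ; bounded = λ () ; complete = λ 1≤x x≤0 → ⊥-elim (ℕ.<⇒≱ 1≤x x≤0) }
∈-perms⁻ (suc n) π∈ with τ , τ∈ , π∈ins ← find (∈-concatMap⁻ (insertions (suc n)) {xs = perms n} π∈)
  with a , b , refl , refl ← ∈-insertions⁻ (suc n) τ π∈ins = IsPermutation-++∷⁺ a b (∈-perms⁻ n τ∈)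

∈-perms⁺ : ∀ n {π} → IsPermutation n π → π ∈ perms n
∈-perms⁺ zero    {[]}    _ = here refl
∈-perms⁺ zero    {x ∷ π} p = let 1≤x , x≤0 = IsPermutation.bounded p (here refl) in ⊥-elim (ℕ.<⇒≱ 1≤x x≤0)
∈-perms⁺ (suc n) {π}     p with a , b , refl ← ∈-∃++ (IsPermutation.complete p (s≤s z≤n) ℕ.≤-refl) =
  ∈-concatMap⁺ (insertions (suc n)) {xs = perms n}
    (lose (∈-perms⁺ n (IsPermutation-++∷⁻ a b p)) (∈-insertions⁺ (suc n) a b))

perms-unique : ∀ n → Unique (perms n)
perms-unique zero    = [] ∷ []
perms-unique (suc n) = concatMap-unique (insertions (suc n)) (perms n) (perms-unique n)
  (λ τ∈ → insertions-unique (suc n) _ (n+1∉ τ∈))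
  (λ τ∈ τ′∈ → insertions-disjoint (suc n) _ _ (n+1∉ τ∈) (n+1∉ τ′∈))
  where
  n+1∉ : ∀ {τ} → τ ∈ perms n → suc n ∉ τ
  n+1∉ τ∈ n+1∈ = ℕ.<-irrefl refl (proj₂ (IsPermutation.bounded (∈-perms⁻ n τ∈) n+1∈))

∈-perms⇒length : ∀ n {π} → π ∈ perms n → length π ≡ n
∈-perms⇒length zero    (here refl) = refl
∈-perms⇒length (suc n) π∈ with τ , τ∈ , π∈ins ← find (∈-concatMap⁻ (insertions (suc n)) {xs = perms n} π∈)
  with a , b , refl , refl ← ∈-insertions⁻ (suc n) τ π∈ins = begin
    length (a ++ suc n ∷ b)        ≡⟨ length-++ a ⟩
    length a + suc (length b)      ≡⟨ ℕ.+-suc (length a) (length b) ⟩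
    suc (length a + length b)      ≡⟨ cong suc (length-++ a) ⟨
    suc (length (a ++ b))          ≡⟨ cong suc (∈-perms⇒length n τ∈) ⟩
    suc n                          ∎
  where open ≡-Reasoning

IsPermutation⇒length : ∀ n {π} → IsPermutation n π → length π ≡ n
IsPermutation⇒length n = ∈-perms⇒length n ∘ ∈-perms⁺ n

map-unique : ∀ {A B : Set} (f : A → B) {xs} → Unique xs → (∀ {x y} → x ∈ xs → y ∈ xs → f x ≡ f y → x ≡ y) →
             Unique (map f xs)
map-unique f {[]}     _         _   = []
map-unique f {x ∷ xs} (x∉ ∷ u) inj =
  All-map⁺ (All.tabulate λ y∈ fx≡fy → All.lookup x∉ y∈ (inj (here refl) (there y∈) fx≡fy)) ∷
  map-unique f u (λ x∈ y∈ → inj (there x∈) (there y∈))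

cartesianProductWith-unique : ∀ {A B C : Set} (f : A → B → C) {xs ys} → Unique xs → Unique ys →
  (∀ {w x y z} → w ∈ xs → x ∈ xs → y ∈ ys → z ∈ ys → f w y ≡ f x z → w ≡ x × y ≡ z) →
  Unique (cartesianProductWith f xs ys)
cartesianProductWith-unique f {[]}     _         _   _   = []
cartesianProductWith-unique f {x ∷ xs} {ys} (x∉ ∷ u) uys inj =
  Unique.++⁺ (map-unique (f x) uys λ y∈ z∈ → proj₂ ∘ inj (here refl) (here refl) y∈ z∈)
             (cartesianProductWith-unique f u uys λ w∈ x∈ → inj (there w∈) (there x∈))
             λ (v∈head , v∈rest) →
               let y , y∈ , v≡ = ∈-map⁻ (f x) v∈head
                   w , z , w∈ , z∈ , v≡′ = ∈-cartesianProductWith⁻ f xs ys v∈rest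
               in All.lookup x∉ w∈ (proj₁ (inj (here refl) (there w∈) y∈ z∈ (trans (sym v≡) v≡′)))

-- Gluing around the maximum

record GluingBounds (A : List ℕ) (m M : ℕ) (B : List ℕ) : Set where
  field
    A-between : ∀ {x} → x ∈ A → m < x × x < M
    m<M       : m < M
    B-below   : ∀ {y} → y ∈ B → y < m

module _ {A m M B} (bounds : GluingBounds A m M B) where
  open GluingBounds bounds

  private
    head-within : ∀ {x} → x ∈ A ++ m ∷ [ M ] → m ≤ x × x ≤ M
    head-within x∈ with ∈-++⁻ A x∈
    ... | inj₁ x∈A                 = ℕ.<⇒≤ (proj₁ (A-between x∈A)) , ℕ.<⇒≤ (proj₂ (A-between x∈A))
    ... | inj₂ (here refl)         = ℕ.≤-refl , ℕ.<⇒≤ m<M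
    ... | inj₂ (there (here refl)) = ℕ.<⇒≤ m<M , ℕ.≤-refl

    head-above-B : ∀ {x y} → x ∈ A ++ m ∷ [ M ] → y ∈ B → y < x
    head-above-B x∈ y∈ = ℕ.<-≤-trans (B-below y∈) (proj₁ (head-within x∈))

    split-occurrence : ∀ {σ s} → FirstBelowLast σ → orderIso σ s ≡ true → s ⊆ A ++ m ∷ M ∷ B →
                       s ⊆ A ++ m ∷ [ M ] ⊎ s ⊆ B
    split-occurrence fbl iso s⊆ = skew-sum-occurrence fbl (A ++ m ∷ [ M ]) B iso
      (subst (_ ⊆_) (sym (++-assoc A (m ∷ [ M ]) B)) s⊆) head-above-B

  Unique-glued : Unique A → Unique B → Unique (A ++ m ∷ M ∷ B)
  Unique-glued uA uB = Unique.++⁺ uA (¬Any⇒All¬ (M ∷ B) m∉ ∷ ¬Any⇒All¬ B M∉ ∷ uB) disjoint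
    where
    m∉ : m ∉ M ∷ B
    m∉ (here refl)  = ℕ.<-irrefl refl m<M
    m∉ (there m∈B) = ℕ.<-irrefl refl (B-below m∈B)
    M∉ : M ∉ B
    M∉ M∈B = ℕ.<-asym m<M (B-below M∈B)
    disjoint : ∀ {x} → ¬ (x ∈ A × x ∈ m ∷ M ∷ B)
    disjoint (x∈A , here refl)          = ℕ.<-irrefl refl (proj₁ (A-between x∈A))
    disjoint (x∈A , there (here refl))  = ℕ.<-irrefl refl (proj₂ (A-between x∈A))
    disjoint (x∈A , there (there x∈B)) = ℕ.<-asym (B-below x∈B) (proj₁ (A-between x∈A))

  glued-noRise : noRiseAfterSmaller [] A ≡ true → noRiseAfterSmaller [] B ≡ true →
                 noRiseAfterSmaller [] (A ++ m ∷ M ∷ B) ≡ true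
  glued-noRise nrA nrB = noRise-++⁺ [] A m (M ∷ B)
    (noRise-∷ʳ-max [] A m (λ x∈A → <ᵇ-false⁺ (ℕ.<⇒≤ (proj₁ (A-between x∈A)))) nrA)
    tail
    where
    m<Aʳ : ∀ {p} → p ∈ A ʳ++ [] → m < p
    m<Aʳ p∈ with ∈-ʳ++⁻ A p∈
    ... | inj₁ p∈A = proj₁ (A-between p∈A)
    B<mAʳ : ∀ {y p} → y ∈ B → p ∈ m ∷ A ʳ++ [] → y < p
    B<mAʳ y∈ (here refl) = B-below y∈
    B<mAʳ y∈ (there p∈)  = ℕ.<-trans (B-below y∈) (m<Aʳ p∈)
    tail : noRiseAfterSmaller (A ʳ++ []) (m ∷ M ∷ B) ≡ true
    tail rewrite any-false⁺ (_<ᵇ m) (A ʳ++ []) (<ᵇ-false⁺ ∘ ℕ.<⇒≤ ∘ m<Aʳ) | ∧-zeroʳ (m <ᵇ M) =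
      trans (noRise-max∷ (m ∷ A ʳ++ []) M B (λ y∈ → ℕ.<-trans (B-below y∈) m<M) B<mAʳ) nrB

  unglued-noRise : noRiseAfterSmaller [] (A ++ m ∷ M ∷ B) ≡ true →
                   noRiseAfterSmaller [] A ≡ true × noRiseAfterSmaller [] B ≡ true
  unglued-noRise nr =
    noRise-++⁻ˡ [] A (m ∷ M ∷ B) nr ,
    trans (sym (noRise-pre-above (AmM ʳ++ []) B B<AmM))
          (noRise-++⁻ʳ [] AmM B (subst (λ π → noRiseAfterSmaller [] π ≡ true) (sym (++-assoc A (m ∷ [ M ]) B))
                                       nr))
    where
    AmM : List ℕ
    AmM = A ++ m ∷ [ M ]
    B<AmM : ∀ {y p} → y ∈ B → p ∈ AmM ʳ++ [] → y < p
    B<AmM y∈ p∈ with ∈-ʳ++⁻ AmM p∈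
    ... | inj₁ p∈AmM = head-above-B p∈AmM y∈

  max∉prefix : M ∉ A ++ [ m ]
  max∉prefix M∈ with ∈-++⁻ A M∈
  ... | inj₁ M∈A        = ℕ.<-irrefl refl (proj₂ (A-between M∈A))
  ... | inj₂ (here refl) = ℕ.<-irrefl refl m<M

  -- The last entry of a 132 lies strictly between the other two, so it is neither m nor M.
  glued-contains-p132 : contains (A ++ m ∷ M ∷ B) p132 ≡ true →
                        contains A p132 ≡ true ⊎ contains B p132 ≡ true
  glued-contains-p132 c with s , s⊆ , iso ← contains⁻ _ p132 c
    with split-occurrence FirstBelowLast-p132 iso s⊆
  ... | inj₂ s⊆B = inj₂ (contains⁺ {σ = p132} s⊆B iso)
  ... | inj₁ s⊆AmM = inj₁ (occurrence-in-A s iso s⊆AmM)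
    where
    occurrence-in-A : ∀ s → orderIso p132 s ≡ true → s ⊆ A ++ m ∷ [ M ] → contains A p132 ≡ true
    occurrence-in-A (x ∷ z ∷ y ∷ []) iso s⊆ =
      contains⁺ {σ = p132} (⊆-++-last {x ∷ [ z ]} A (m ∷ [ M ]) s⊆ y∉mM) iso
      where
      x<y : x < y
      x<y = proj₁ (proj₂ (orderIso-p132⁻ x z y iso))
      y<z : y < z
      y<z = proj₂ (proj₂ (orderIso-p132⁻ x z y iso))
      y∉mM : y ∉ m ∷ [ M ]
      y∉mM (here refl)         = ℕ.<⇒≱ x<y (proj₁ (head-within (lookup s⊆ (here refl))))
      y∉mM (there (here refl)) = ℕ.<⇒≱ y<z (proj₂ (head-within (lookup s⊆ (there (here refl)))))
    occurrence-in-A []                   ()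
    occurrence-in-A s@(_ ∷ [])             iso with () ← orderIso⇒length≡ p132 s iso
    occurrence-in-A s@(_ ∷ _ ∷ [])         iso with () ← orderIso⇒length≡ p132 s iso
    occurrence-in-A s@(_ ∷ _ ∷ _ ∷ _ ∷ _) iso with () ← orderIso⇒length≡ p132 s iso

  glued-contains-extend⁻ : ∀ {τ L} → FirstBelowLast (extend L τ) →
                           contains (A ++ m ∷ M ∷ B) (extend L τ) ≡ true →
                           contains A τ ≡ true ⊎ contains B (extend L τ) ≡ true
  glued-contains-extend⁻ {τ} {L} fbl c with s , s⊆ , iso ← contains⁻ _ (extend L τ) c
    with split-occurrence fbl iso s⊆
  ... | inj₂ s⊆B = inj₂ (contains⁺ {σ = extend L τ} s⊆B iso)
  ... | inj₁ s⊆AmM with u , v , refl , τ≅u , 1L≅v ← orderIso-++⁻ (map suc τ) (1 ∷ [ L ]) s iso =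
    inj₁ (contains⁺ {σ = τ}
           (⊆-prefix u v A (m ∷ [ M ]) s⊆AmM (ℕ.≤-reflexive (orderIso⇒length≡ (1 ∷ [ L ]) v 1L≅v)))
           (trans (sym (orderIso-mapˡ suc suc-preservesOrder τ u)) τ≅u))

  glued-contains-extend⁺ : ∀ {τ L} → 1 < L → (∀ {p} → p ∈ τ → 1 ≤ p × suc p < L) →
                           contains A τ ≡ true → contains (A ++ m ∷ M ∷ B) (extend L τ) ≡ true
  glued-contains-extend⁺ {τ} {L} 1<L τ-bounds c with s , s⊆A , τ≅s ← contains⁻ A τ c =
    contains⁺ {σ = extend L τ} (++⁺ s⊆A (refl ∷ refl ∷ minimum B))
      (orderIso-++⁺ (map suc τ) (1 ∷ [ L ]) s (m ∷ [ M ])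
        (trans (orderIso-mapˡ suc suc-preservesOrder τ s) τ≅s) 1L≅mM cross)
    where
    1L≅mM : orderIso (1 ∷ [ L ]) (m ∷ [ M ]) ≡ true
    1L≅mM rewrite <ᵇ-true⁺ 1<L | <ᵇ-false⁺ (ℕ.<⇒≤ 1<L) | <ᵇ-true⁺ m<M | <ᵇ-false⁺ (ℕ.<⇒≤ m<M) = refl
    m<y : ∀ {y} → y ∈ s → m < y
    m<y y∈ = proj₁ (A-between (lookup s⊆A y∈))
    y<M : ∀ {y} → y ∈ s → y < M
    y<M y∈ = proj₂ (A-between (lookup s⊆A y∈))
    pair-agree : ∀ {p y x′ y′} → p ∈ τ → y ∈ s → (x′ , y′) ∈ zip (1 ∷ [ L ]) (m ∷ [ M ]) →
                 agree (suc p) y (x′ , y′) ≡ true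
    pair-agree {p} {y} p∈τ y∈ (here refl) =
      agree⁺ (suc p) y 1 m (sym (<ᵇ-false⁺ (ℕ.<⇒≤ (m<y y∈))))
             (trans (<ᵇ-true⁺ (s≤s (proj₁ (τ-bounds p∈τ)))) (sym (<ᵇ-true⁺ (m<y y∈))))
    pair-agree {p} {y} p∈τ y∈ (there (here refl)) =
      agree⁺ (suc p) y L M (trans (<ᵇ-true⁺ (proj₂ (τ-bounds p∈τ))) (sym (<ᵇ-true⁺ (y<M y∈))))
             (trans (<ᵇ-false⁺ (ℕ.<⇒≤ (proj₂ (τ-bounds p∈τ)))) (sym (<ᵇ-false⁺ (ℕ.<⇒≤ (y<M y∈)))))
    cross : ∀ {x y x′ y′} → (x , y) ∈ zip (map suc τ) s → (x′ , y′) ∈ zip (1 ∷ [ L ]) (m ∷ [ M ]) →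
            agree x y (x′ , y′) ≡ true
    cross xy∈ x′y′∈ with x∈ , y∈ ← ∈-zip⁻ (map suc τ) s xy∈ with _ , p∈τ , refl ← ∈-map⁻ suc x∈ =
      pair-agree p∈τ y∈ x′y′∈

glue : ℕ → ℕ → List ℕ → List ℕ → List ℕ
glue M j α β = map (_+ suc j) α ++ suc j ∷ M ∷ β

module _ {i j α β} (pα : IsPermutation i α) (pβ : IsPermutation j β) where
  private
    module α = IsPermutation pα
    module β = IsPermutation pβ

  glue-bounds : GluingBounds (map (_+ suc j) α) (suc j) (suc (suc (i + j))) β
  glue-bounds = record
    { A-between = A-between
    ; m<M       = s≤s (s≤s (ℕ.m≤n+m j i))
    ; B-below   = s≤s ∘ proj₂ ∘ β.bounded }
    where
    A-between : ∀ {x} → x ∈ map (_+ suc j) α → suc j < x × x < suc (suc (i + j))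
    A-between x∈ with a , a∈ , refl ← ∈-map⁻ (_+ suc j) x∈ =
      ℕ.+-monoˡ-≤ (suc j) (proj₁ (α.bounded a∈)) ,
      s≤s (subst (a + suc j ≤_) (ℕ.+-suc i j) (ℕ.+-monoˡ-≤ (suc j) (proj₂ (α.bounded a∈))))

  glue-IsPermutation : IsPermutation (suc (suc (i + j))) (glue (suc (suc (i + j))) j α β)
  glue-IsPermutation = record
    { unique   = Unique-glued glue-bounds (Unique.map⁺ (ℕ.+-cancelʳ-≡ _ _ _) α.unique) β.unique
    ; bounded  = bounded
    ; complete = complete }
    where
    open GluingBounds glue-bounds
    A : List ℕ
    A = map (_+ suc j) α
    bounded : ∀ {x} → x ∈ glue (suc (suc (i + j))) j α β → 1 ≤ x × x ≤ suc (suc (i + j))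
    bounded x∈ with ∈-++⁻ A x∈
    ... | inj₁ x∈A                  =
      ℕ.≤-trans (s≤s z≤n) (ℕ.<⇒≤ (proj₁ (A-between x∈A))) , ℕ.<⇒≤ (proj₂ (A-between x∈A))
    ... | inj₂ (here refl)          = s≤s z≤n , ℕ.<⇒≤ m<M
    ... | inj₂ (there (here refl))  = s≤s z≤n , ℕ.≤-refl
    ... | inj₂ (there (there x∈β)) = proj₁ (β.bounded x∈β) , ℕ.<⇒≤ (ℕ.<-trans (B-below x∈β) m<M)
    complete : ∀ {x} → 1 ≤ x → x ≤ suc (suc (i + j)) → x ∈ glue (suc (suc (i + j))) j α β
    complete {x} 1≤x x≤M with x ℕ.≤? j | x ℕ.≟ suc j | x ℕ.≟ suc (suc (i + j))
    ... | yes x≤j | _        | _        = ∈-++⁺ʳ A (there (there (β.complete 1≤x x≤j)))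
    ... | no  _   | yes refl | _        = ∈-++⁺ʳ A (here refl)
    ... | no  _   | no  _    | yes refl = ∈-++⁺ʳ A (there (here refl))
    ... | no  x≰j | no  x≢m  | no  x≢M  =
      ∈-++⁺ˡ (subst (_∈ A) (ℕ.m∸n+n≡m (ℕ.<⇒≤ m<x)) (∈-map⁺ (_+ suc j) (α.complete 1≤x∸m x∸m≤i)))
      where
      m<x : suc j < x
      m<x = ℕ.≤∧≢⇒< (ℕ.≰⇒> x≰j) (x≢m ∘ sym)
      1≤x∸m : 1 ≤ x ∸ suc j
      1≤x∸m = ℕ.m<n⇒0<n∸m m<x
      x∸m≤i : x ∸ suc j ≤ i
      x∸m≤i = subst (x ∸ suc j ≤_) (ℕ.m+n∸n≡m i j)
                (ℕ.∸-monoˡ-≤ (suc j) (ℕ.≤-pred (ℕ.≤∧≢⇒< x≤M x≢M)))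

avoids-p132⇒max-splits : ∀ Y M B → Unique (Y ++ M ∷ B) → (∀ {x} → x ∈ Y → x < M) →
                         (∀ {y} → y ∈ B → y < M) → avoids (Y ++ M ∷ B) p132 ≡ true →
                         ∀ {x y} → x ∈ Y → y ∈ B → y < x
avoids-p132⇒max-splits Y M B u Y<M B<M av {x} {y} x∈ y∈ with ℕ.<-cmp x y
... | tri> _ _ y<x = y<x
... | tri≈ _ refl _ = ⊥-elim (Unique-++⁻-disjoint Y (M ∷ B) u x∈ (there y∈))
... | tri< x<y _ _ = ⊥-elim (avoids⁻ (Y ++ M ∷ B) p132 av
        (contains⁺ {σ = p132} (++⁺ (from∈ x∈) (refl ∷ from∈ y∈)) (orderIso-p132⁺ (Y<M x∈) x<y (B<M y∈))))

-- 132-avoidance puts B below A and m; the Motzkin condition at the rise m M puts A above m.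
unglue-bounds : ∀ {A m M B} → IsPermutation M (A ++ m ∷ M ∷ B) → avoids (A ++ m ∷ M ∷ B) p132 ≡ true →
                noRiseAfterSmaller [] (A ++ m ∷ M ∷ B) ≡ true → GluingBounds A m M B
unglue-bounds {A} {m} {M} {B} p av nr = record
  { A-between = λ a∈ → m<a a∈ , a<M a∈
  ; m<M       = m<M
  ; B-below   = λ y∈ → y<Am (∈-++⁺ʳ A (here refl)) y∈ }
  where
  open IsPermutation p
  A#mMB : ∀ {x} → x ∈ A → x ∉ m ∷ M ∷ B
  A#mMB = Unique-++⁻-disjoint A (m ∷ M ∷ B) unique
  mMB-unique : Unique (m ∷ M ∷ B)
  mMB-unique = Unique-resp-⊆ (++⁺ˡ A ⊆-refl) unique
  <M : ∀ {x} → x ∈ A ++ m ∷ M ∷ B → x ≢ M → x < M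
  <M x∈ = ℕ.≤∧≢⇒< (proj₂ (bounded x∈))
  m<M : m < M
  m<M with m≢ ∷ _ ← mMB-unique = <M (∈-++⁺ʳ A (here refl)) (All.lookup m≢ (here refl))
  a<M : ∀ {a} → a ∈ A → a < M
  a<M a∈ = <M (∈-++⁺ˡ a∈) (λ { refl → A#mMB a∈ (there (here refl)) })
  y<M : ∀ {y} → y ∈ B → y < M
  y<M y∈ with _ ∷ M≢ ∷ _ ← mMB-unique =
    <M (∈-++⁺ʳ A (there (there y∈))) (λ { refl → All.lookup M≢ y∈ refl })
  y<Am : ∀ {x y} → x ∈ A ++ [ m ] → y ∈ B → y < x
  y<Am = avoids-p132⇒max-splits (A ++ [ m ]) M B (subst Unique (sym (++-assoc A [ m ] (M ∷ B))) unique)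
          (λ x∈ → [ a<M , (λ { (here refl) → m<M }) ]′ (∈-++⁻ A x∈)) y<M
          (subst (λ π → avoids π p132 ≡ true) (sym (++-assoc A [ m ] (M ∷ B))) av)
  nothing-below-m : any (_<ᵇ m) (A ʳ++ []) ≡ false
  nothing-below-m with e ← noRise-++⁻ʳ [] A (m ∷ M ∷ B) nr rewrite <ᵇ-true⁺ m<M =
    not-true⁻ (proj₁ (∧-true⁻ e))
  m<a : ∀ {a} → a ∈ A → m < a
  m<a a∈ = ℕ.≤∧≢⇒< (<ᵇ-false⁻ (any-false⁻ (_<ᵇ m) (A ʳ++ []) nothing-below-m (∈-ʳ++⁺ˡ A a∈)))
                    (λ { refl → A#mMB a∈ (here refl) })

module _ {n j A B} (p : IsPermutation (suc (suc n)) (A ++ suc j ∷ suc (suc n) ∷ B))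
         (bounds : GluingBounds A (suc j) (suc (suc n)) B) where
  private
    module π = IsPermutation p
  open GluingBounds bounds

  private
    π-cases : ∀ {x} → x ∈ A ++ suc j ∷ suc (suc n) ∷ B →
              x ∈ A ⊎ x ≡ suc j ⊎ x ≡ suc (suc n) ⊎ x ∈ B
    π-cases x∈ with ∈-++⁻ A x∈
    ... | inj₁ x∈A                 = inj₁ x∈A
    ... | inj₂ (here refl)         = inj₂ (inj₁ refl)
    ... | inj₂ (there (here refl)) = inj₂ (inj₂ (inj₁ refl))
    ... | inj₂ (there (there x∈B)) = inj₂ (inj₂ (inj₂ x∈B))

  unglue-j≤n : j ≤ n
  unglue-j≤n = ℕ.≤-pred (ℕ.≤-pred m<M)

  unglue-IsPermutationʳ : IsPermutation j B
  unglue-IsPermutationʳ = record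
    { unique   = Unique-resp-⊆ (++⁺ˡ A (suc j ∷ʳ suc (suc n) ∷ʳ ⊆-refl)) π.unique
    ; bounded  = λ y∈ → proj₁ (π.bounded (∈-++⁺ʳ A (there (there y∈)))) , ℕ.≤-pred (B-below y∈)
    ; complete = λ 1≤y y≤j →
        in-B (π-cases (π.complete 1≤y (ℕ.≤-trans y≤j (ℕ.m≤n⇒m≤1+n (ℕ.m≤n⇒m≤1+n unglue-j≤n))))) y≤j }
    where
    in-B : ∀ {y} → y ∈ A ⊎ y ≡ suc j ⊎ y ≡ suc (suc n) ⊎ y ∈ B → y ≤ j → y ∈ B
    in-B (inj₁ y∈A)               y≤j = ⊥-elim (ℕ.<⇒≱ (proj₁ (A-between y∈A)) (ℕ.m≤n⇒m≤1+n y≤j))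
    in-B (inj₂ (inj₁ refl))        y≤j = ⊥-elim (ℕ.<-irrefl refl y≤j)
    in-B (inj₂ (inj₂ (inj₁ refl))) y≤j = ⊥-elim (ℕ.<⇒≱ m<M (ℕ.m≤n⇒m≤1+n y≤j))
    in-B (inj₂ (inj₂ (inj₂ y∈B)))  _   = y∈B

  unshift : map (_+ suc j) (map (_∸ suc j) A) ≡ A
  unshift = trans (sym (map-∘ A)) (map-id-local (All.tabulate (ℕ.m∸n+n≡m ∘ ℕ.<⇒≤ ∘ proj₁ ∘ A-between)))

  unglue-IsPermutationˡ : IsPermutation (n ∸ j) (map (_∸ suc j) A)
  unglue-IsPermutationˡ = record
    { unique   = Unique.map⁻ (subst Unique (sym unshift) (Unique-resp-⊆ (++⁺ʳ _ ⊆-refl) π.unique))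
    ; bounded  = bounded
    ; complete = complete }
    where
    y+m≤n+1 : ∀ {y} → y ≤ n ∸ j → y + suc j ≤ suc n
    y+m≤n+1 {y} y≤ = subst (y + suc j ≤_) (trans (ℕ.+-suc (n ∸ j) j) (cong suc (ℕ.m∸n+n≡m unglue-j≤n)))
                           (ℕ.+-monoˡ-≤ (suc j) y≤)
    bounded : ∀ {y} → y ∈ map (_∸ suc j) A → 1 ≤ y × y ≤ n ∸ j
    bounded y∈ with x , x∈A , refl ← ∈-map⁻ (_∸ suc j) y∈ =
      ℕ.m<n⇒0<n∸m (proj₁ (A-between x∈A)) ,
      ℕ.∸-monoˡ-≤ (suc j) (ℕ.≤-pred (proj₂ (A-between x∈A)))
    complete : ∀ {y} → 1 ≤ y → y ≤ n ∸ j → y ∈ map (_∸ suc j) A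
    complete {y} 1≤y y≤
      with π-cases (π.complete (ℕ.≤-trans 1≤y (ℕ.m≤m+n y (suc j))) (ℕ.m≤n⇒m≤1+n (y+m≤n+1 y≤)))
    ... | inj₁ y+m∈A = subst (_∈ map (_∸ suc j) A) (ℕ.m+n∸n≡m y (suc j)) (∈-map⁺ (_∸ suc j) y+m∈A)
    ... | inj₂ (inj₁ y+m≡m) = ⊥-elim (ℕ.<-irrefl (sym y+m≡m) (ℕ.m<n+m (suc j) 1≤y))
    ... | inj₂ (inj₂ (inj₁ y+m≡M)) = ⊥-elim (ℕ.<-irrefl y+m≡M (s≤s (y+m≤n+1 y≤)))
    ... | inj₂ (inj₂ (inj₂ y+m∈B)) = ⊥-elim (ℕ.<-asym (B-below y+m∈B) (ℕ.m<n+m (suc j) 1≤y))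

glue-injective : ∀ {M j j′ α α′ β β′} →
                 GluingBounds (map (_+ suc j) α) (suc j) M β → GluingBounds (map (_+ suc j′) α′) (suc j′) M β′ →
                 glue M j α β ≡ glue M j′ α′ β′ → j ≡ j′ × α ≡ α′ × β ≡ β′
glue-injective {M} {j} {j′} {α} {α′} {β} {β′} b b′ eq
  with A≡A′ , β≡β′ ← ++∷-cancel (map (_+ suc j) α ++ [ suc j ]) β (map (_+ suc j′) α′ ++ [ suc j′ ]) β′
                       (trans (++-assoc _ [ suc j ] (M ∷ β)) (trans eq (sym (++-assoc _ [ suc j′ ] (M ∷ β′)))))
                       (max∉prefix b) (max∉prefix b′)
  with shifted≡ , refl ← ∷ʳ-injective _ _ A≡A′ =
  refl , map-injective (ℕ.+-cancelʳ-≡ _ _ _) shifted≡ , β≡β′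

max∷≢glue : ∀ {M j α β β₀} → GluingBounds (map (_+ suc j) α) (suc j) M β → M ∷ β₀ ≢ glue M j α β
max∷≢glue {α = []}    b refl = ℕ.<-irrefl refl (GluingBounds.m<M b)
max∷≢glue {α = a ∷ α} b refl = ℕ.<-irrefl refl (proj₂ (GluingBounds.A-between b (here refl)))

-- Counting through the decomposition

length-cartesianProductWith : ∀ {A B C : Set} (f : A → B → C) xs ys →
                              length (cartesianProductWith f xs ys) ≡ length xs * length ys
length-cartesianProductWith f []       ys = refl
length-cartesianProductWith f (x ∷ xs) ys = begin
  length (map (f x) ys ++ cartesianProductWith f xs ys)         ≡⟨ length-++ (map (f x) ys) ⟩
  length (map (f x) ys) + length (cartesianProductWith f xs ys) ≡⟨ cong₂ _+_ (length-map (f x) ys)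
                                                                     (length-cartesianProductWith f xs ys) ⟩
  length ys + length xs * length ys                             ∎
  where open ≡-Reasoning

length-concatMap : ∀ {A B : Set} (f : A → List B) xs → length (concatMap f xs) ≡ sum (map (length ∘ f) xs)
length-concatMap f []       = refl
length-concatMap f (x ∷ xs) = trans (length-++ (f x)) (cong (λ n → length (f x) + n) (length-concatMap f xs))

pos-sum : ∀ {A : Set} (h : A → ℕ) xs → + sum (map h xs) ≡ foldr ℤ._+_ (+ 0) (map (λ x → + h x) xs)
pos-sum h []       = refl
pos-sum h (x ∷ xs) = trans (ℤ.pos-+ (h x) _) (cong (λ z → + h x ℤ.+ z) (pos-sum h xs))

motzkinAvoider? : ∀ σ π → Dec ((isMotzkin π ∧ avoids π σ) ≡ true)
motzkinAvoider? σ π = (isMotzkin π ∧ avoids π σ) Bool.≟ true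

module Decomposition (σ : ℕ → List ℕ) (L : ℕ → ℕ)
  (σ-suc : ∀ k → σ (suc k) ≡ extend (L k) (σ k))
  (σ-bounds : ∀ k {p} → p ∈ σ k → 1 ≤ p × suc p < L k)
  (1<L : ∀ k → 1 < L k) where

  record Admissible (k : ℕ) (π : List ℕ) : Set where
    field
      avoids-p132 : avoids π p132 ≡ true
      noRise      : noRiseAfterSmaller [] π ≡ true
      avoids-σ    : avoids π (σ k) ≡ true

  𝔐 : ℕ → ℕ → List (List ℕ)
  𝔐 k n = motzkinAvoiding n (σ k)

  selected? : ∀ k π → Dec ((isMotzkin π ∧ avoids π (σ k)) ≡ true)
  selected? k = motzkinAvoider? (σ k)

  ∈-𝔐⁺ : ∀ {k n π} → IsPermutation n π → Admissible k π → π ∈ 𝔐 k n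
  ∈-𝔐⁺ {k} {n} p a = ∈-filter⁺ (selected? k) (∈-perms⁺ n p) (∧-true⁺ (∧-true⁺ avoids-p132 noRise) avoids-σ)
    where open Admissible a

  ∈-𝔐⁻ : ∀ k n {π} → π ∈ 𝔐 k n → IsPermutation n π × Admissible k π
  ∈-𝔐⁻ k n {π} π∈ with π∈perms , good ← ∈-filter⁻ (selected? k) {xs = perms n} π∈
    with motzkin , avσ ← ∧-true⁻ {isMotzkin π} good with av132 , nr ← ∧-true⁻ {avoids π p132} motzkin =
    ∈-perms⁻ n π∈perms , record { avoids-p132 = av132 ; noRise = nr ; avoids-σ = avσ }

  𝔐-unique : ∀ k n → Unique (𝔐 k n)
  𝔐-unique k n = Unique.filter⁺ (selected? k) (perms-unique n)

  FirstBelowLast-σ-suc : ∀ k → FirstBelowLast (σ (suc k))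
  FirstBelowLast-σ-suc k =
    subst FirstBelowLast (sym (σ-suc k)) (FirstBelowLast-extend (1<L k) (proj₂ ∘ σ-bounds k))

  module _ {k M : ℕ} {β : List ℕ} (β<M : ∀ {y} → y ∈ β → y < M) where

    max∷-admissible⁺ : Admissible (suc k) β → Admissible (suc k) (M ∷ β)
    max∷-admissible⁺ a = record
      { avoids-p132 = avoids⁺ (M ∷ β) p132
                        (avoids⁻ β p132 avoids-p132 ∘ contains-max∷⁻ FirstBelowLast-p132 β<M)
      ; noRise      = trans (noRise-max∷ [] M β β<M λ _ ()) noRise
      ; avoids-σ    = avoids⁺ (M ∷ β) (σ (suc k))
                        (avoids⁻ β (σ (suc k)) avoids-σ ∘ contains-max∷⁻ (FirstBelowLast-σ-suc k) β<M) }
      where open Admissible a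

    max∷-admissible⁻ : Admissible (suc k) (M ∷ β) → Admissible (suc k) β
    max∷-admissible⁻ a = record
      { avoids-p132 = avoids-resp-⊇ {β} p132 (M ∷ʳ ⊆-refl) avoids-p132
      ; noRise      = trans (sym (noRise-max∷ [] M β β<M λ _ ())) noRise
      ; avoids-σ    = avoids-resp-⊇ {β} (σ (suc k)) (M ∷ʳ ⊆-refl) avoids-σ }
      where open Admissible a

  module _ {k m M : ℕ} {α β : List ℕ} (bounds : GluingBounds (map (_+ m) α) m M β) where

    private
      contains-shifted : ∀ τ → contains (map (_+ m) α) τ ≡ contains α τ
      contains-shifted = contains-map (_+ m) (+-preservesOrder m) α
      noRise-shifted : noRiseAfterSmaller [] (map (_+ m) α) ≡ noRiseAfterSmaller [] α
      noRise-shifted = noRise-map (_+ m) (+-preservesOrder m) [] α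
      σ-suc-contains : ∀ π → contains π (σ (suc k)) ≡ contains π (extend (L k) (σ k))
      σ-suc-contains π = cong (contains π) (σ-suc k)

    glued-admissible⁺ : Admissible k α → Admissible (suc k) β → Admissible (suc k) (map (_+ m) α ++ m ∷ M ∷ β)
    glued-admissible⁺ aα aβ = record
      { avoids-p132 = avoids⁺ π p132 λ c →
          [ avoids⁻ α p132 α.avoids-p132 ∘ trans (sym (contains-shifted p132)) ,
            avoids⁻ β p132 β.avoids-p132 ]′
          (glued-contains-p132 bounds c)
      ; noRise      = glued-noRise bounds (trans noRise-shifted α.noRise) β.noRise
      ; avoids-σ    = avoids⁺ π (σ (suc k)) λ c →
          [ avoids⁻ α (σ k) α.avoids-σ ∘ trans (sym (contains-shifted (σ k))) ,
            avoids⁻ β (σ (suc k)) β.avoids-σ ∘ trans (σ-suc-contains β) ]′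
          (glued-contains-extend⁻ bounds (subst FirstBelowLast (σ-suc k) (FirstBelowLast-σ-suc k))
            (trans (sym (σ-suc-contains π)) c)) }
      where
      π : List ℕ
      π = map (_+ m) α ++ m ∷ M ∷ β
      module α = Admissible aα
      module β = Admissible aβ

    glued-admissible⁻ : Admissible (suc k) (map (_+ m) α ++ m ∷ M ∷ β) → Admissible k α × Admissible (suc k) β
    glued-admissible⁻ a =
      record
        { avoids-p132 = avoids⁺ α p132 λ c →
            avoids⁻ π p132 avoids-p132 (contains-A {p132} (trans (contains-shifted p132) c))
        ; noRise      = trans (sym noRise-shifted) (proj₁ (unglued-noRise bounds noRise))
        ; avoids-σ    = avoids⁺ α (σ k) λ c → avoids⁻ π (σ (suc k)) avoids-σ
            (trans (σ-suc-contains π) (glued-contains-extend⁺ bounds (1<L k) (σ-bounds k)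
              (trans (contains-shifted (σ k)) c))) } ,
      record
        { avoids-p132 = avoids-resp-⊇ {β} p132 β⊆π avoids-p132
        ; noRise      = proj₂ (unglued-noRise bounds noRise)
        ; avoids-σ    = avoids-resp-⊇ {β} (σ (suc k)) β⊆π avoids-σ }
      where
      open Admissible a
      π : List ℕ
      π = map (_+ m) α ++ m ∷ M ∷ β
      β⊆π : β ⊆ π
      β⊆π = ++⁺ˡ (map (_+ m) α) (m ∷ʳ M ∷ʳ ⊆-refl)
      contains-A : ∀ {τ} → contains (map (_+ m) α) τ ≡ true → contains π τ ≡ true
      contains-A {τ} c =
        let s , s⊆ , iso = contains⁻ (map (_+ m) α) τ c in contains⁺ {π} {τ} (++⁺ʳ (m ∷ M ∷ β) s⊆) iso

  glued-with : ℕ → ℕ → ℕ → List (List ℕ)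
  glued-with k n i = cartesianProductWith (glue (suc (suc n)) (n ∸ i)) (𝔐 k i) (𝔐 (suc k) (n ∸ i))

  glued : ℕ → ℕ → List (List ℕ)
  glued k zero    = []
  glued k (suc n) = concatMap (glued-with k n) (upTo (suc n))

  -- Cutting at the maximum n+1: either (n+1) ∷ β, or α shifted above m, then m, n+1, β,
  -- with |α| + |β| = n − 1 and m = |β| + 1.
  decomposition : ℕ → ℕ → List (List ℕ)
  decomposition k n = map (suc n ∷_) (𝔐 (suc k) n) ++ glued k n

  module _ {k n i α β} (i≤n : i ≤ n) (α∈ : α ∈ 𝔐 k i) (β∈ : β ∈ 𝔐 (suc k) (n ∸ i)) where
    private
      i+j≡n : i + (n ∸ i) ≡ n
      i+j≡n = ℕ.m+[n∸m]≡n i≤n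
      pα : IsPermutation i α
      pα = proj₁ (∈-𝔐⁻ k i α∈)
      pβ : IsPermutation (n ∸ i) β
      pβ = proj₁ (∈-𝔐⁻ (suc k) (n ∸ i) β∈)

    glued-bounds : GluingBounds (map (_+ suc (n ∸ i)) α) (suc (n ∸ i)) (suc (suc n)) β
    glued-bounds =
      subst (λ n′ → GluingBounds (map (_+ suc (n ∸ i)) α) (suc (n ∸ i)) (suc (suc n′)) β) i+j≡n
            (glue-bounds pα pβ)

    glued-∈-𝔐 : glue (suc (suc n)) (n ∸ i) α β ∈ 𝔐 (suc k) (suc (suc n))
    glued-∈-𝔐 = ∈-𝔐⁺
      (subst (λ n′ → IsPermutation (suc (suc n′)) (glue (suc (suc n′)) (n ∸ i) α β)) i+j≡n
             (glue-IsPermutation pα pβ))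
      (glued-admissible⁺ glued-bounds (proj₂ (∈-𝔐⁻ k i α∈)) (proj₂ (∈-𝔐⁻ (suc k) (n ∸ i) β∈)))

  decomposition⊆𝔐 : ∀ k n {π} → π ∈ decomposition k n → π ∈ 𝔐 (suc k) (suc n)
  decomposition⊆𝔐 k n π∈ with ∈-++⁻ (map (suc n ∷_) (𝔐 (suc k) n)) π∈
  ... | inj₁ π∈max∷ with β , β∈ , refl ← ∈-map⁻ (suc n ∷_) π∈max∷ =
    let pβ , aβ = ∈-𝔐⁻ (suc k) n β∈
    in ∈-𝔐⁺ (IsPermutation-++∷⁺ [] β pβ) (max∷-admissible⁺ (s≤s ∘ proj₂ ∘ IsPermutation.bounded pβ) aβ)
  decomposition⊆𝔐 k (suc n) π∈ | inj₂ π∈glued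
    with i , i∈ , π∈glued-with ← find (∈-concatMap⁻ (glued-with k n) {xs = upTo (suc n)} π∈glued)
    with α , β , α∈ , β∈ , refl ← ∈-cartesianProductWith⁻ (glue (suc (suc n)) (n ∸ i)) (𝔐 k i) _ π∈glued-with =
    glued-∈-𝔐 (ℕ.≤-pred (∈-upTo⁻ i∈)) α∈ β∈

  split-at-max∈glued : ∀ k n A m B → IsPermutation (suc n) (A ++ m ∷ suc n ∷ B) →
                       Admissible (suc k) (A ++ m ∷ suc n ∷ B) → A ++ m ∷ suc n ∷ B ∈ glued k n
  split-at-max∈glued k n A zero B p _ =
    ⊥-elim (ℕ.<⇒≱ (proj₁ (IsPermutation.bounded p (∈-++⁺ʳ A (here refl)))) z≤n)
  split-at-max∈glued k zero A (suc j) B p a =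
    ⊥-elim (ℕ.<⇒≱ (GluingBounds.m<M (unglue-bounds p avoids-p132 noRise)) (s≤s z≤n))
    where open Admissible a
  split-at-max∈glued k (suc n) A (suc j) B p a =
    subst (_∈ glued k (suc n)) (cong (_++ suc j ∷ suc (suc n) ∷ B) (unshift p bounds))
      (∈-concatMap⁺ (glued-with k n) (lose (∈-upTo⁺ (s≤s (ℕ.m∸n≤m n j)))
        (subst (λ j′ → glue (suc (suc n)) j α B ∈
                       cartesianProductWith (glue (suc (suc n)) j′) (𝔐 k (n ∸ j)) (𝔐 (suc k) j′))
               (sym (ℕ.m∸[m∸n]≡n (unglue-j≤n p bounds)))
               (∈-cartesianProductWith⁺ (glue (suc (suc n)) j)
                  (∈-𝔐⁺ (unglue-IsPermutationˡ p bounds) aα) (∈-𝔐⁺ (unglue-IsPermutationʳ p bounds) aB)))))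
    where
    open Admissible a
    bounds : GluingBounds A (suc j) (suc (suc n)) B
    bounds = unglue-bounds p avoids-p132 noRise
    α : List ℕ
    α = map (_∸ suc j) A
    admissible-parts : Admissible k α × Admissible (suc k) B
    admissible-parts =
      glued-admissible⁻ (subst (λ A′ → GluingBounds A′ (suc j) (suc (suc n)) B) (sym (unshift p bounds)) bounds)
                        (subst (λ A′ → Admissible (suc k) (A′ ++ suc j ∷ suc (suc n) ∷ B))
                               (sym (unshift p bounds)) a)
    aα : Admissible k α
    aα = proj₁ admissible-parts
    aB : Admissible (suc k) B
    aB = proj₂ admissible-parts

  𝔐⊆decomposition : ∀ k n {π} → π ∈ 𝔐 (suc k) (suc n) → π ∈ decomposition k n
  𝔐⊆decomposition k n π∈ with p , a ← ∈-𝔐⁻ (suc k) (suc n) π∈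
    with A , B , refl ← ∈-∃++ (IsPermutation.complete p (s≤s z≤n) ℕ.≤-refl) with initLast A
  ... | [] = ∈-++⁺ˡ (∈-map⁺ (suc n ∷_) (∈-𝔐⁺ pB (max∷-admissible⁻ B<n+1 a)))
    where
    pB : IsPermutation n B
    pB = IsPermutation-++∷⁻ [] B p
    B<n+1 : ∀ {y} → y ∈ B → y < suc n
    B<n+1 = s≤s ∘ proj₂ ∘ IsPermutation.bounded pB
  ... | A′ ∷ʳ′ m = ∈-++⁺ʳ (map (suc n ∷_) (𝔐 (suc k) n))
    (subst (_∈ glued k n) (sym (++-assoc A′ [ m ] (suc n ∷ B)))
      (split-at-max∈glued k n A′ m B (subst (IsPermutation (suc n)) (++-assoc A′ [ m ] (suc n ∷ B)) p)
                                      (subst (Admissible (suc k)) (++-assoc A′ [ m ] (suc n ∷ B)) a)))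

  decomposition-unique : ∀ k n → Unique (decomposition k n)
  decomposition-unique k n =
    Unique.++⁺ (Unique.map⁺ ∷-injectiveʳ (𝔐-unique (suc k) n)) (glued-unique n) (max∷#glued n)
    where
    glued-with-unique : ∀ {n i} → i ≤ n → Unique (glued-with k n i)
    glued-with-unique {n} {i} i≤n =
      cartesianProductWith-unique (glue (suc (suc n)) (n ∸ i)) (𝔐-unique k i) (𝔐-unique (suc k) (n ∸ i))
        λ α∈ α′∈ β∈ β′∈ eq → proj₂ (glue-injective (glued-bounds i≤n α∈ β∈) (glued-bounds i≤n α′∈ β′∈) eq)
    index-unique : ∀ {n i i′ π} → i ∈ upTo (suc n) → i′ ∈ upTo (suc n) →
                   π ∈ glued-with k n i → π ∈ glued-with k n i′ → i ≡ i′
    index-unique {n} {i} {i′} i∈ i′∈ π∈ π∈′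
      with α , β , α∈ , β∈ , refl ← ∈-cartesianProductWith⁻ (glue (suc (suc n)) (n ∸ i)) (𝔐 k i) _ π∈
      with α′ , β′ , α′∈ , β′∈ , eq ← ∈-cartesianProductWith⁻ (glue (suc (suc n)) (n ∸ i′)) (𝔐 k i′) _ π∈′
      with _ , refl , _ ← glue-injective (glued-bounds (ℕ.≤-pred (∈-upTo⁻ i∈)) α∈ β∈)
                                         (glued-bounds (ℕ.≤-pred (∈-upTo⁻ i′∈)) α′∈ β′∈) eq =
      trans (sym (IsPermutation⇒length i (proj₁ (∈-𝔐⁻ k i α∈))))
            (IsPermutation⇒length i′ (proj₁ (∈-𝔐⁻ k i′ α′∈)))
    glued-unique : ∀ n → Unique (glued k n)
    glued-unique zero    = []
    glued-unique (suc n) = concatMap-unique (glued-with k n) (upTo (suc n)) (Unique.upTo⁺ (suc n))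
      (glued-with-unique ∘ ℕ.≤-pred ∘ ∈-upTo⁻) index-unique
    max∷#glued : ∀ n {π} → ¬ (π ∈ map (suc n ∷_) (𝔐 (suc k) n) × π ∈ glued k n)
    max∷#glued (suc n) (π∈max∷ , π∈glued)
      with _ , _ , refl ← ∈-map⁻ (suc (suc n) ∷_) π∈max∷
      with i , i∈ , π∈glued-with ← find (∈-concatMap⁻ (glued-with k n) {xs = upTo (suc n)} π∈glued)
      with α , β , α∈ , β∈ , eq ← ∈-cartesianProductWith⁻ (glue (suc (suc n)) (n ∸ i)) (𝔐 k i) _ π∈glued-with =
      max∷≢glue (glued-bounds (ℕ.≤-pred (∈-upTo⁻ i∈)) α∈ β∈) eq

  glued-with-count : ℕ → ℕ → ℕ → ℕ
  glued-with-count k n i = length (𝔐 k i) * length (𝔐 (suc k) (n ∸ i))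

  length-glued : ∀ k n → length (glued k (suc n)) ≡ sum (map (glued-with-count k n) (upTo (suc n)))
  length-glued k n = trans (length-concatMap (glued-with k n) (upTo (suc n)))
    (cong sum (map-cong (λ i → length-cartesianProductWith (glue (suc (suc n)) (n ∸ i)) (𝔐 k i)
                                                           (𝔐 (suc k) (n ∸ i)))
                        (upTo (suc n))))

  length-𝔐-suc : ∀ k n → length (𝔐 (suc k) (suc n)) ≡ length (𝔐 (suc k) n) + length (glued k n)
  length-𝔐-suc k n = begin
    length (𝔐 (suc k) (suc n))
      ≡⟨ length-≡-from-∈ (𝔐-unique (suc k) (suc n)) (decomposition-unique k n)
                          (𝔐⊆decomposition k n) (decomposition⊆𝔐 k n) ⟩
    length (decomposition k n)
      ≡⟨ length-++ (map (suc n ∷_) (𝔐 (suc k) n)) ⟩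
    length (map (suc n ∷_) (𝔐 (suc k) n)) + length (glued k n)
      ≡⟨ cong (_+ length (glued k n)) (length-map (suc n ∷_) (𝔐 (suc k) n)) ⟩
    length (𝔐 (suc k) n) + length (glued k n) ∎
    where open ≡-Reasoning

  length-𝔐-zero : ∀ k → length (𝔐 (suc k) 0) ≡ 1
  length-𝔐-zero k = cong length (filter-accept (selected? (suc k)) {x = []} {xs = []} avoids-[])
    where
    avoids-[] : (isMotzkin [] ∧ avoids [] (σ (suc k))) ≡ true
    avoids-[] with a , p , c , eq , _ ← FirstBelowLast-σ-suc k rewrite eq = refl

  X⊛-glued-count : ∀ k n → (X ⊛ (N (σ k) ⊛ N (σ (suc k)))) n ≡ + length (glued k n)
  X⊛-glued-count k zero    = refl
  X⊛-glued-count k (suc n) = begin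
    (X ⊛ (N (σ k) ⊛ N (σ (suc k)))) (suc n)
      ≡⟨ X-⊛-suc (N (σ k) ⊛ N (σ (suc k))) n ⟩
    foldr ℤ._+_ (+ 0) (map (λ i → + length (𝔐 k i) ℤ.* + length (𝔐 (suc k) (n ∸ i))) (upTo (suc n)))
      ≡⟨ cong (foldr ℤ._+_ (+ 0)) (map-cong (λ i → sym (ℤ.pos-* (length (𝔐 k i)) _)) (upTo (suc n))) ⟩
    foldr ℤ._+_ (+ 0) (map (λ i → + glued-with-count k n i) (upTo (suc n)))
      ≡⟨ pos-sum (glued-with-count k n) (upTo (suc n)) ⟨
    + sum (map (glued-with-count k n) (upTo (suc n)))
      ≡⟨ cong +_ (length-glued k n) ⟨
    + length (glued k (suc n)) ∎
    where open ≡-Reasoning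

  N-equation : ∀ k → N (σ (suc k)) ≐ (1ₚ ⊕ ((X ⊛ N (σ (suc k))) ⊕ ((X ⊛ X) ⊛ (N (σ k) ⊛ N (σ (suc k))))))
  N-equation k zero    = cong +_ (length-𝔐-zero k)
  N-equation k (suc n) = begin
    + length (𝔐 (suc k) (suc n))
      ≡⟨ cong +_ (length-𝔐-suc k n) ⟩
    + (length (𝔐 (suc k) n) + length (glued k n))
      ≡⟨ ℤ.pos-+ (length (𝔐 (suc k) n)) _ ⟩
    N (σ (suc k)) n ℤ.+ + length (glued k n)
      ≡⟨ cong₂ ℤ._+_ (X-⊛-suc (N (σ (suc k))) n) (trans (X-⊛-suc G n) (X⊛-glued-count k n)) ⟨
    (X ⊛ N (σ (suc k))) (suc n) ℤ.+ (X ⊛ G) (suc n)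
      ≡⟨ cong (λ z → (X ⊛ N (σ (suc k))) (suc n) ℤ.+ z) (⊛-assoc X X H (suc n)) ⟨
    (X ⊛ N (σ (suc k))) (suc n) ℤ.+ ((X ⊛ X) ⊛ H) (suc n)
      ≡⟨ ℤ.+-identityˡ _ ⟨
    + 0 ℤ.+ ((X ⊛ N (σ (suc k))) (suc n) ℤ.+ ((X ⊛ X) ⊛ H) (suc n)) ∎
    where
    open ≡-Reasoning
    H G : PS
    H = N (σ k) ⊛ N (σ (suc k))
    G = X ⊛ H

-- The two pattern families

-- pattern₁ k is zigzag 1 k and pattern₂ k is suc k ∷ zigzag 2 k, by definition.
zigzag : ℕ → ℕ → List ℕ
zigzag c k = concatMap (λ i → k ∸ i ∷ [ c + k + i ]) (upTo k)

zigzag-suc : ∀ c k → zigzag c (suc k) ≡ extend (c + suc k + k) (zigzag c k)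
zigzag-suc c k = begin
  concatMap (pair (suc k)) (upTo (suc k))
    ≡⟨ cong (concatMap (pair (suc k))) (upTo-∷ʳ k) ⟨
  concatMap (pair (suc k)) (upTo k ++ [ k ])
    ≡⟨ concatMap-++ (pair (suc k)) (upTo k) [ k ] ⟩
  concatMap (pair (suc k)) (upTo k) ++ suc k ∸ k ∷ [ c + suc k + k ]
    ≡⟨ cong₂ (λ xs x → xs ++ x ∷ [ c + suc k + k ]) shifted (ℕ.m+n∸n≡m 1 k) ⟩
  map suc (zigzag c k) ++ 1 ∷ [ c + suc k + k ] ∎
  where
  open ≡-Reasoning
  pair : ℕ → ℕ → List ℕ
  pair k i = k ∸ i ∷ [ c + k + i ]
  pointwise : All.All (λ i → pair (suc k) i ≡ map suc (pair k i)) (upTo k)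
  pointwise = All.tabulate λ {i} i∈ →
    cong₂ (λ x y → x ∷ [ y ]) (ℕ.+-∸-assoc 1 (ℕ.<⇒≤ (∈-upTo⁻ i∈))) (cong (_+ i) (ℕ.+-suc c k))
  shifted : concatMap (pair (suc k)) (upTo k) ≡ map suc (zigzag c k)
  shifted = trans (cong concat (map-cong-local pointwise)) (sym (map-concatMap suc (pair k) (upTo k)))

zigzag-bounds : ∀ c k {p} → p ∈ zigzag c k → 1 ≤ p × p < c + k + k
zigzag-bounds c k p∈ with i , i∈ , p∈pair ← find (∈-concatMap⁻ (λ i → k ∸ i ∷ [ c + k + i ]) {xs = upTo k} p∈)
  with i<k ← ∈-upTo⁻ i∈ | p∈pair
... | here refl = ℕ.m<n⇒0<n∸m i<k , (begin-strict
  k ∸ i      ≤⟨ ℕ.m∸n≤m k i ⟩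
  k          <⟨ ℕ.m<n+m k (ℕ.<-≤-trans (ℕ.≤-<-trans z≤n i<k) (ℕ.m≤n+m k c)) ⟩
  c + k + k  ∎)
  where open ℕ.≤-Reasoning
... | there (here refl) =
  ℕ.≤-trans (ℕ.≤-<-trans z≤n i<k) (ℕ.≤-trans (ℕ.m≤n+m k c) (ℕ.m≤m+n (c + k) i)) , ℕ.+-monoʳ-< (c + k) i<k

pattern₁-suc : ∀ k → pattern₁ (suc k) ≡ extend (1 + suc k + k) (pattern₁ k)
pattern₁-suc = zigzag-suc 1

pattern₂-suc : ∀ k → pattern₂ (suc k) ≡ extend (2 + suc k + k) (pattern₂ k)
pattern₂-suc k = cong (suc (suc k) ∷_) (zigzag-suc 2 k)

zigzag-bounds-suc : ∀ c k {p} → p ∈ zigzag c k → 1 ≤ p × suc p < c + suc k + k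
zigzag-bounds-suc c k {p} p∈ with 1≤p , p< ← zigzag-bounds c k p∈ =
  1≤p , subst (suc p <_) (cong (_+ k) (sym (ℕ.+-suc c k))) (s≤s p<)

pattern₂-bounds : ∀ k {p} → p ∈ pattern₂ k → 1 ≤ p × suc p < 2 + suc k + k
pattern₂-bounds k (here refl) = s≤s z≤n , s≤s (s≤s (s≤s (ℕ.m≤m+n k k)))
pattern₂-bounds k (there p∈)  = zigzag-bounds-suc 2 k p∈

N-empty : N [] ≐ 0ₚ
N-empty n =
  trans (cong (λ l → + length l)
              (filter-none (motzkinAvoider? []) {xs = perms n} (All.tabulate λ {π} _ → rejected π)))
        (sym (0ₚ-coeff n))
  where
  rejected : ∀ π → (isMotzkin π ∧ avoids π []) ≢ true
  rejected π rewrite contains⁺ {π} {[]} (minimum π) refl | ∧-zeroʳ (isMotzkin π) = λ ()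

N-singleton : N [ 1 ] ≐ 1ₚ
N-singleton zero    = refl
N-singleton (suc n) =
  cong (λ l → + length l) (filter-none (motzkinAvoider? [ 1 ]) {xs = perms (suc n)} (All.tabulate rejected))
  where
  rejected : ∀ {π} → π ∈ perms (suc n) → (isMotzkin π ∧ avoids π [ 1 ]) ≢ true
  rejected {x ∷ π} _
    rewrite contains⁺ {x ∷ π} {[ 1 ]} (refl ∷ minimum π) refl | ∧-zeroʳ (isMotzkin (x ∷ π)) = λ ()
  rejected {[]} π∈ with () ← ∈-perms⇒length (suc n) π∈

module D₁ = Decomposition pattern₁ (λ k → 1 + suc k + k) pattern₁-suc (zigzag-bounds-suc 1)
                          (λ _ → s≤s (s≤s z≤n))

module D₂ = Decomposition pattern₂ (λ k → 2 + suc k + k) pattern₂-suc pattern₂-bounds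
                          (λ _ → s≤s (s≤s z≤n))

module _ where
  open CommutativeRing PS-commutativeRing using (setoid; +-congˡ; *-congˡ; -‿cong)
  open SetoidReasoning setoid
  open PS-Solver using (solve; _:=_; _:+_; _:*_; :-_; _:-_; con)

  denominator-cong : ∀ {F G} → F ≐ G → denominator F ≐ denominator G
  denominator-cong F≐G = +-congˡ {1ₚ ⊕ (⊖ X)} (-‿cong (*-congˡ {X ⊛ X} F≐G))

  Uh-one : Uh 1 ≐ ((const (+ 2) ⊛ Uh 0) ⊛ denominator (N (pattern₁ 0)))
  Uh-one = begin
    Uh 1
      ≈⟨ solve 1 (λ x → con (+ 2) :+ con (ℤ.- + 2) :* x
                   := (con (+ 2) :* con (+ 1)) :* ((con (+ 1) :- x) :- (x :* x) :* con (+ 0)))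
               (λ _ → refl) X ⟩
    (const (+ 2) ⊛ Uh 0) ⊛ denominator 0ₚ
      ≈⟨ *-congˡ {const (+ 2) ⊛ Uh 0} (denominator-cong N-empty) ⟨
    (const (+ 2) ⊛ Uh 0) ⊛ denominator (N (pattern₁ 0)) ∎

  V₂ : ℕ → PS
  V₂ k = Uh (suc k) ⊕ (twoX ⊛ Uh k)

  V₂-recurrence : ∀ k → V₂ (suc (suc k)) ≐ ((twoOneMinusX ⊛ V₂ (suc k)) ⊕ (minusFourX² ⊛ V₂ k))
  V₂-recurrence k = solve 3 (λ u′ u x →
    let t = con (+ 2) :+ con (ℤ.- + 2) :* x
        f = con (ℤ.- + 4) :* (x :* x)
        w = con (+ 2) :* x
        u″ = t :* u′ :+ f :* u
    in (t :* u″ :+ f :* u′) :+ w :* u″ := t :* (u″ :+ w :* u′) :+ f :* (u′ :+ w :* u))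
    (λ _ → refl) (Uh (suc k)) (Uh k) X

  V₂-one : V₂ 1 ≐ ((const (+ 2) ⊛ V₂ 0) ⊛ denominator (N (pattern₂ 0)))
  V₂-one = begin
    V₂ 1
      ≈⟨ solve 1 (λ x →
           let t = con (+ 2) :+ con (ℤ.- + 2) :* x
               f = con (ℤ.- + 4) :* (x :* x)
               w = con (+ 2) :* x
           in (t :* t :+ f :* con (+ 1)) :+ w :* t
              := (con (+ 2) :* (t :+ w :* con (+ 1))) :* ((con (+ 1) :- x) :- (x :* x) :* con (+ 1)))
         (λ _ → refl) X ⟩
    (const (+ 2) ⊛ V₂ 0) ⊛ denominator 1ₚ
      ≈⟨ *-congˡ {const (+ 2) ⊛ V₂ 0} (denominator-cong N-singleton) ⟨
    (const (+ 2) ⊛ V₂ 0) ⊛ denominator (N (pattern₂ 0)) ∎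

  twoX-distrib : ∀ u′ u → (twoX ⊛ (u′ ⊕ (twoX ⊛ u))) ≐ ((twoX ⊛ u′) ⊕ ((twoX ⊛ twoX) ⊛ u))
  twoX-distrib u′ u = solve 3 (λ u′ u x →
    let w = con (+ 2) :* x in w :* (u′ :+ w :* u) := w :* u′ :+ (w :* w) :* u) (λ _ → refl) u′ u X

corollary3p7 : (k : ℕ) → k ≥ 1 →
    ((N (pattern₁ k) ⊛ (X ⊛ Uh k)) ≐ (twoX ⊛ Uh (k ∸ 1)))
    × ((N (pattern₂ k) ⊛ (X ⊛ (Uh (suc k) ⊕ (twoX ⊛ Uh k))))
        ≐ ((twoX ⊛ Uh k) ⊕ ((twoX ⊛ twoX) ⊛ Uh (k ∸ 1))))
corollary3p7 (suc k) _ =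
  ChebyshevQuotient.F⊛[X⊛V]≐twoX⊛V (N ∘ pattern₁) Uh D₁.N-equation (λ _ _ → refl) Uh-one k ,
  λ n → trans (ChebyshevQuotient.F⊛[X⊛V]≐twoX⊛V (N ∘ pattern₂) V₂ D₂.N-equation V₂-recurrence V₂-one k n)
              (twoX-distrib (Uh (suc k)) (Uh k) n)
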